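{- Work constructively (IZF). Let $\Sigma$ be a purely relational signature and $\mathbb{T}$ a normal regular equality-free theory over $\Sigma$. Then for every $\Sigma$-structure $A$ the embedding $\eta_A : A \to \mathrm{Ch}_{\mathbb{T}}(A)$ is $\mathbb{T}$-conservative; consequently $\mathrm{Ch}_{\mathbb{T}}$ together with $\eta$ forms a chase functor for $\mathbb{T}$.
   Context: Signatures need not be discrete; purely relational means no function or constant symbols. A normal regular sequent has the form $\varphi(\vec x)\vdash_{\vec x}\exists\vec y\,\psi(\vec x,\vec y)$ with $\varphi,\psi$ finite conjunctions of atomic formulas and $\psi\vdash_{\vec x,\vec y}\varphi$ derivable in pure logic; a normal regular theory is a family of such; equality-free means no equality occurs in its axioms. Regular formulas: built from atomic formulas (incl. equality), $\top,\wedge,\exists$; $\vdash^{\mathbb{T}}$ is derivability in regular logic. A homomorphism $f:A\to B$ is $\mathbb{T}$-conservative if for every regular $\varphi(\vec x)$ and tuple $\vec a$ in $A$ with $B\models\varphi(f(\vec a))$ there is a regular $\psi(\vec x)$ with $A\models\psi(\vec a)$ and $\psi\vdash^{\mathbb{T}}_{\vec x}\varphi$. A chase functor for $\mathbb{T}$ is a functor $W:\mathbf{Str}(\Sigma)\to\mathbf{Mod}(\mathbb{T})$ with a natural transformation $\eta:1\to I\circ W$ ($I$ the inclusion of models into structures) with every $\eta_A$ $\mathbb{T}$-conservative. One-step extension $\mathbb{T}^1(A)$: domain the disjoint union of $|A|$ with all triples $(\tau,\vec a,j)$, $\tau=(\varphi\vdash_{\vec x}\exists\vec y\,\psi)$ an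 axiom of $\mathbb{T}$, $A\models\varphi(\vec a)$, $0\le j<\ell(\vec y)$; $\iota_A$ the inclusion of $|A|$. $R^{\mathbb{T}^1(A)}$ consists of $\iota_A(R^A)$ together with, for each such $\tau,\vec a$ and each conjunct $R(\vec t(\vec x,\vec y))$ of $\psi$, the tuple $\vec t(\iota(\vec a),\vec b)$ with $\vec b=((\tau,\vec a,j))_j$. This is functorial in $A$. $\mathrm{Ch}_{\mathbb{T}}(A)$ is the colimit of the chain $A\to\mathbb{T}^1(A)\to\mathbb{T}^1(\mathbb{T}^1(A))\to\cdots$ of the inclusions $\iota$ (a relation holds iff it holds at some stage), functorial in $A$, and $\eta_A$ is the colimit inclusion of the $0$th stage $A$. -}

module Defs where

open import Data.Nat using (ℕ; zero; suc; _+_)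
open import Data.Fin using (Fin; zero; suc)
open import Data.Vec using (Vec; []; _∷_; map; lookup; tabulate; _++_)
open import Data.Vec.Properties using (map-∘; map-cong; lookup-map; map-++; tabulate-∘)
open import Data.List using (List; []; _∷_; foldr)
open import Data.List.Relation.Unary.Any using (Any)
import Data.List.Relation.Unary.Any as Any
open import Data.List.Relation.Unary.All using (All)
open import Data.Product using (Σ; _×_; _,_; proj₁; proj₂)
open import Data.Sum using (_⊎_; inj₁; inj₂)
open import Data.Unit using () renaming (⊤ to Unit; tt to unit)
open import Data.Empty using (⊥)
open import Function using (_∘_; id)
open import Relation.Binary.PropositionalEquality
  using (_≡_; refl; sym; trans; cong; subst)

-- Purely relational signatures (no decidable equality assumed on symbols)

record Sig : Set₁ where
  field
    Rel : Set
    ar  : Rel → ℕ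

module Sigma (S : Sig) where
  open Sig S

  record Str : Set₁ where
    field
      Car  : Set
      relS : (R : Rel) → Vec Car (ar R) → Set
  open Str public

  IsHom : (A B : Str) → (Car A → Car B) → Set
  IsHom A B f = ∀ R (c : Vec (Car A) (ar R)) → relS A R c → relS B R (map f c)

  record Hom (A B : Str) : Set where
    constructor hom
    field
      fun  : Car A → Car B
      pres : IsHom A B fun
  open Hom public

  idHom : (A : Str) → Hom A A
  idHom A = hom id (λ R c r → subst (relS A R) (sym (map-id c)) r)
    where
      map-id : ∀ {n} (xs : Vec (Car A) n) → map id xs ≡ xs
      map-id [] = refl
      map-id (x ∷ xs) = cong (x ∷_) (map-id xs)

  _∘H_ : ∀ {A B C} → Hom B C → Hom A B → Hom A C
  _∘H_ {C = C} g f = hom (fun g ∘ fun f)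
    (λ R c r → subst (relS C R) (sym (map-∘ (fun g) (fun f) c))
                     (pres g R _ (pres f R c r)))

  -- Regular formulas in a context of n variables (de Bruijn; variable
  -- zero is the most recently bound one). Terms are just variables.

  data Fm (n : ℕ) : Set where
    rel  : (R : Rel) → Vec (Fin n) (ar R) → Fm n
    eq   : Fin n → Fin n → Fm n
    ⊤    : Fm n
    _∧_  : Fm n → Fm n → Fm n
    ex   : Fm (suc n) → Fm n

  data Atom (n : ℕ) : Set where
    ratom : (R : Rel) → Vec (Fin n) (ar R) → Atom n
    eatom : Fin n → Fin n → Atom n

  atom : ∀ {n} → Atom n → Fm n
  atom (ratom R ts) = rel R ts
  atom (eatom i j)  = eq i j

  conj : ∀ {n} → List (Atom n) → Fm n
  conj = foldr (λ α φ → atom α ∧ φ) ⊤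

  -- ∃ y₀ … y_{m-1}: the first m variables of the context m + n are bound
  exs : ∀ m {n} → Fm (m + n) → Fm n
  exs zero    φ = φ
  exs (suc m) φ = exs m (ex φ)

  lift : ∀ {m n} → (Fin m → Fin n) → Fin (suc m) → Fin (suc n)
  lift ρ zero    = zero
  lift ρ (suc i) = suc (ρ i)

  ren : ∀ {m n} → (Fin m → Fin n) → Fm m → Fm n
  ren ρ (rel R ts) = rel R (map ρ ts)
  ren ρ (eq i j)   = eq (ρ i) (ρ j)
  ren ρ ⊤          = ⊤
  ren ρ (φ ∧ ψ)    = ren ρ φ ∧ ren ρ ψ
  ren ρ (ex φ)     = ex (ren (lift ρ) φ)

  wk : ∀ {n} → Fm n → Fm (suc n)
  wk = ren suc

  xvar : ∀ m {n} → Fin n → Fin (m + n)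
  xvar zero    i = i
  xvar (suc m) i = suc (xvar m i)

  σ : ∀ {n} → Fin n → Fin (suc n) → Fin n
  σ i zero    = i
  σ i (suc k) = k

  ⟦_⟧ : ∀ {n} → Fm n → (A : Str) → Vec (Car A) n → Set
  ⟦ rel R ts ⟧ A v = relS A R (map (lookup v) ts)
  ⟦ eq i j ⟧   A v = lookup v i ≡ lookup v j
  ⟦ ⊤ ⟧        A v = Unit
  ⟦ φ ∧ ψ ⟧    A v = ⟦ φ ⟧ A v × ⟦ ψ ⟧ A v
  ⟦ ex φ ⟧     A v = Σ (Car A) λ x → ⟦ φ ⟧ A (x ∷ v)

  presF : ∀ {A B} (f : Hom A B) {n} (φ : Fm n) (v : Vec (Car A) n) →
          ⟦ φ ⟧ A v → ⟦ φ ⟧ B (map (fun f) v)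
  presF {B = B} f (rel R ts) v p =
    subst (relS B R)
      (trans (sym (map-∘ (fun f) (lookup v) ts))
             (map-cong (λ i → sym (lookup-map i (fun f) v)) ts))
      (pres f R _ p)
  presF f (eq i j) v p =
    trans (lookup-map i (fun f) v) (trans (cong (fun f) p) (sym (lookup-map j (fun f) v)))
  presF f ⊤ v p = unit
  presF f (φ ∧ ψ) v (p , q) = presF f φ v p , presF f ψ v q
  presF f (ex φ) v (x , p) = fun f x , presF f φ (x ∷ v) p

  -- Regular theories whose axioms have the shape
  --   φ(x⃗) ⊢_x⃗ ∃ y⃗ ψ(x⃗,y⃗),  φ, ψ finite conjunctions of atomic formulas.
  -- ψ lives in the context ny + nx (y's first, then x's).

  record Theory : Set₁ where
    field
      Ax   : Set
      nx   : Ax → ℕ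
      ny   : Ax → ℕ
      pre  : (τ : Ax) → List (Atom (nx τ))
      post : (τ : Ax) → List (Atom (ny τ + nx τ))
  open Theory public

  record Seqs : Set₁ where
    field
      I   : Set
      ctx : I → ℕ
      lhs : (i : I) → Fm (ctx i)
      rhs : (i : I) → Fm (ctx i)
  open Seqs public

  axSeqs : Theory → Seqs
  axSeqs T = record
    { I = Ax T ; ctx = nx T
    ; lhs = λ τ → conj (pre T τ)
    ; rhs = λ τ → exs (ny T τ) (conj (post T τ)) }

  pureLogic : Seqs
  pureLogic = record { I = ⊥ ; ctx = λ () ; lhs = λ () ; rhs = λ () }

  -- Derivability φ ⊢_n ψ in regular logic (Johnstone, D1.3) from axioms Γ
  data Der (Γ : Seqs) : ∀ {n} → Fm n → Fm n → Set where
    axiom  : (i : I Γ) → Der Γ (lhs Γ i) (rhs Γ i)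
    idty   : ∀ {n} {φ : Fm n} → Der Γ φ φ
    cut    : ∀ {n} {φ ψ χ : Fm n} → Der Γ φ ψ → Der Γ ψ χ → Der Γ φ χ
    rename : ∀ {m n} (ρ : Fin m → Fin n) {φ ψ : Fm m} →
             Der Γ φ ψ → Der Γ (ren ρ φ) (ren ρ ψ)
    eq-refl : ∀ {n} (i : Fin n) → Der Γ ⊤ (eq i i)
    eq-subst : ∀ {n} (φ : Fm (suc n)) (i j : Fin n) →
               Der Γ (eq i j ∧ ren (σ i) φ) (ren (σ j) φ)
    ⊤-intro : ∀ {n} {φ : Fm n} → Der Γ φ ⊤
    ∧-elimˡ : ∀ {n} {φ ψ : Fm n} → Der Γ (φ ∧ ψ) φ
    ∧-elimʳ : ∀ {n} {φ ψ : Fm n} → Der Γ (φ ∧ ψ) ψ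
    ∧-intro : ∀ {n} {φ ψ χ : Fm n} → Der Γ φ ψ → Der Γ φ χ → Der Γ φ (ψ ∧ χ)
    ∃-down : ∀ {n} {φ : Fm (suc n)} {ψ : Fm n} → Der Γ φ (wk ψ) → Der Γ (ex φ) ψ
    ∃-up   : ∀ {n} {φ : Fm (suc n)} {ψ : Fm n} → Der Γ (ex φ) ψ → Der Γ φ (wk ψ)
    frobenius : ∀ {n} {φ : Fm n} {ψ : Fm (suc n)} →
                Der Γ (φ ∧ ex ψ) (ex (wk φ ∧ ψ))

  _⊢[_]_ : ∀ {n} → Fm n → Theory → Fm n → Set
  ψ ⊢[ T ] φ = Der (axSeqs T) ψ φ

  IsNormal : Theory → Set
  IsNormal T = ∀ τ → Der pureLogic (conj (post T τ)) (ren (xvar (ny T τ)) (conj (pre T τ)))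

  data IsRelAtom {n} : Atom n → Set where
    isRel : ∀ R ts → IsRelAtom (ratom R ts)

  EqualityFree : Theory → Set
  EqualityFree T = ∀ τ → All IsRelAtom (pre T τ) × All IsRelAtom (post T τ)

  IsModel : Theory → Str → Set
  IsModel T M = ∀ τ (a : Vec (Car M) (nx T τ)) →
    ⟦ conj (pre T τ) ⟧ M a → ⟦ exs (ny T τ) (conj (post T τ)) ⟧ M a

  Conservative : Theory → (A B : Str) → (Car A → Car B) → Set
  Conservative T A B f = ∀ {n} (φ : Fm n) (a : Vec (Car A) n) →
    ⟦ φ ⟧ B (map f a) → Σ (Fm n) λ ψ → ⟦ ψ ⟧ A a × ψ ⊢[ T ] φ

  -- chase functor (action on morphisms given as underlying functions;
  -- equalities of morphisms are pointwise)
  record IsChaseFunctor (T : Theory) (W : Str → Str)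
           (W₁ : ∀ {A B} → Hom A B → Car (W A) → Car (W B))
           (η : ∀ A → Car A → Car (W A)) : Set₁ where
    field
      W-model : ∀ A → IsModel T (W A)
      W₁-hom  : ∀ {A B} (f : Hom A B) → IsHom (W A) (W B) (W₁ f)
      W₁-id   : ∀ A (x : Car (W A)) → W₁ (idHom A) x ≡ x
      W₁-∘    : ∀ {A B C} (g : Hom B C) (f : Hom A B) (x : Car (W A)) →
                W₁ (g ∘H f) x ≡ W₁ g (W₁ f x)
      η-hom   : ∀ A → IsHom A (W A) (η A)
      η-nat   : ∀ {A B} (f : Hom A B) (x : Car A) → W₁ f (η A x) ≡ η B (fun f x)
      η-cons  : ∀ A → Conservative T A (W A) (η A)

  module OneStep (T : Theory) where

    New : Str → Set
    New A = Σ (Ax T) λ τ → Σ (Vec (Car A) (nx T τ)) λ a →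
            ⟦ conj (pre T τ) ⟧ A a × Fin (ny T τ)

    T1Car : Str → Set
    T1Car A = Car A ⊎ New A

    val : (A : Str) (τ : Ax T) (a : Vec (Car A) (nx T τ)) →
          ⟦ conj (pre T τ) ⟧ A a → Vec (T1Car A) (ny T τ + nx T τ)
    val A τ a p = tabulate (λ j → inj₂ (τ , a , p , j)) ++ map inj₁ a

    data Contrib {X : Set} {k : ℕ} (w : Vec X k) : Atom k → (R : Rel) → Vec X (ar R) → Set where
      mk : ∀ {R ts c} → c ≡ map (lookup w) ts → Contrib w (ratom R ts) R c

    data T1Rel (A : Str) (R : Rel) (c : Vec (T1Car A) (ar R)) : Set where
      old : (d : Vec (Car A) (ar R)) → relS A R d → c ≡ map inj₁ d → T1Rel A R c
      new : (τ : Ax T) (a : Vec (Car A) (nx T τ)) (p : ⟦ conj (pre T τ) ⟧ A a) →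
            Any (λ α → Contrib (val A τ a p) α R c) (post T τ) → T1Rel A R c

    T1 : Str → Str
    T1 A = record { Car = T1Car A ; relS = T1Rel A }

    T1fun : ∀ {A B} → Hom A B → T1Car A → T1Car B
    T1fun f (inj₁ x) = inj₁ (fun f x)
    T1fun f (inj₂ (τ , a , p , j)) = inj₂ (τ , map (fun f) a , presF f (conj (pre T τ)) a p , j)

    private
      val-map : ∀ {A B} (f : Hom A B) τ a p →
                map (T1fun f) (val A τ a p) ≡ val B τ (map (fun f) a) (presF f (conj (pre T τ)) a p)
      val-map f τ a p =
        trans (map-++ (T1fun f) (tabulate _) (map inj₁ a))
              (cong₂' (sym (tabulate-∘ (T1fun f) _))
                      (trans (sym (map-∘ (T1fun f) inj₁ a)) (map-∘ inj₁ (fun f) a)))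
        where
          cong₂' : ∀ {m n} {X : Set} {xs xs' : Vec X m} {ys ys' : Vec X n} →
                   xs ≡ xs' → ys ≡ ys' → xs ++ ys ≡ xs' ++ ys'
          cong₂' refl refl = refl

    T1Hom : ∀ {A B} → Hom A B → Hom (T1 A) (T1 B)
    T1Hom {A} {B} f = hom (T1fun f) pr
      where
        pr : IsHom (T1 A) (T1 B) (T1fun f)
        pr R c (old d r e) =
          old (map (fun f) d) (pres f R d r)
              (trans (cong (map (T1fun f)) e)
                     (trans (sym (map-∘ (T1fun f) inj₁ d)) (map-∘ inj₁ (fun f) d)))
        pr R c (new τ a p any) =
          new τ (map (fun f) a) (presF f (conj (pre T τ)) a p) (Any.map g any)
          where
            g : ∀ {α} → Contrib (val A τ a p) α R c →
                Contrib (val B τ (map (fun f) a) (presF f (conj (pre T τ)) a p)) α R (map (T1fun f) c)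
            g (mk {ts = ts} e) =
              mk (trans (cong (map (T1fun f)) e)
                   (trans (sym (map-∘ (T1fun f) (lookup (val A τ a p)) ts))
                     (map-cong (λ i → trans (sym (lookup-map i (T1fun f) (val A τ a p)))
                                            (cong (λ w → lookup w i) (val-map f τ a p))) ts)))

    -- Since every ι is a coproduct injection, the colimit carrier is
    -- represented canonically as the disjoint union of the elements
    -- newly added at each stage.

    stage : ℕ → Str → Str
    stage zero    A = A
    stage (suc k) A = T1 (stage k A)

    stageHom : ∀ k {A B} → Hom A B → Hom (stage k A) (stage k B)
    stageHom zero    f = f
    stageHom (suc k) f = T1Hom (stageHom k f)

    NewAt : Str → ℕ → Set
    NewAt A zero    = Car A
    NewAt A (suc k) = New (stage k A)

    ChCar : Str → Set
    ChCar A = Σ ℕ (NewAt A)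

    incl : ∀ {A} k → Car (stage k A) → ChCar A
    incl zero    x        = zero , x
    incl (suc k) (inj₁ x) = incl k x
    incl (suc k) (inj₂ t) = suc k , t

    embed : ∀ {A} k → NewAt A k → Car (stage k A)
    embed zero    x = x
    embed (suc k) t = inj₂ t

    ChRel : (A : Str) (R : Rel) → Vec (ChCar A) (ar R) → Set
    ChRel A R c = Σ ℕ λ k → Σ (Vec (Car (stage k A)) (ar R)) λ d →
                  relS (stage k A) R d × map (incl k) d ≡ c

    Ch : Str → Str
    Ch A = record { Car = ChCar A ; relS = ChRel A }

    chMap : ∀ {A B} → Hom A B → ChCar A → ChCar B
    chMap f (k , t) = incl k (fun (stageHom k f) (embed k t))

    η : (A : Str) → Car A → ChCar A
    η A = incl zero

module Submission where

-- If T¹(B) ⊨ φ(b⃗) for old elements b⃗, flatten φ to ∃z⃗ (facts ∧ equations) with witnesses in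
-- T¹(B). Every new element and every new fact of T¹(B) comes from a trigger (τ, a⃗) with
-- B ⊨ pre_τ(a⃗). Let ψ(b⃗) state, over B, the premises of the triggers involved, the old facts and
-- the equalities between old elements. Then B ⊨ ψ(b⃗), and ψ ⊢^T φ by firing τ once per trigger
-- and using the fresh witnesses y⃗ for the new elements. Equality of triggers is not decidable, so
-- firings are shared along a union–find over the finitely many coincidences that the witnesses
-- force. A regular formula true in the colimit is already true at a finite stage, so η is
-- conservative as a composite of one-step inclusions; the colimit is a model because, T being
-- equality-free, fresh witnesses never need to be equal to anything.

open import Defs
open import Axiom.UniquenessOfIdentityProofs.WithK using (uip)
open import Data.Empty using (⊥-elim)
open import Data.Fin using (Fin; zero; suc; _↑ˡ_; _↑ʳ_; splitAt)
import Data.Fin as Fin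
open import Data.Fin.Properties using (¬Fin0)
open import Data.List using (List; []; _∷_; [_])
import Data.List as List
open import Data.List.Membership.Propositional using (_∈_)
open import Data.List.Relation.Unary.All using (All; []; _∷_)
import Data.List.Relation.Unary.All as All
open import Data.List.Relation.Unary.All.Properties using (++⁻ˡ; ++⁻ʳ; concat⁻; tabulate⁻)
open import Data.List.Relation.Unary.Any using (Any; here; there)
import Data.List.Relation.Unary.Any as Any
import Data.List.Relation.Unary.Any.Properties as AnyP
open import Data.Maybe using (Maybe; just; nothing)
import Data.Maybe as Maybe
open import Data.Nat using (ℕ; zero; suc; _+_; _⊔_; _≤_; z≤n; _≤′_; ≤′-refl; ≤′-step)
open import Data.Nat.Properties using (≤⇒≤′; ≤′-trans; m≤m⊔n; m≤n⊔m; ≤-trans; ≤-refl; n≤1+n; 1+n≰n)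
open import Data.Product using (Σ; _×_; _,_; proj₁; proj₂)
import Data.Product as Product
open import Data.Sum using (_⊎_; inj₁; inj₂; [_,_]′)
import Data.Sum as Sum
open import Data.Sum.Properties using (inj₁-injective; inj₂-injective; ≡-dec)
open import Data.Unit using () renaming (tt to unit)
open import Data.Vec using (Vec; []; _∷_; map; lookup; tabulate) renaming (_++_ to _++ᵛ_)
open import Data.Vec.Properties
  using (∷-injectiveˡ; ∷-injectiveʳ; map-∘; map-cong; map-id; lookup-map; lookup∘tabulate; tabulate∘lookup; tabulate-cong;
         lookup-++ˡ; lookup-++ʳ)
import Data.Vec.Functional as VF
import Data.Vec.Functional.Properties as VFP
open import Function using (_∘_; id)
open import Relation.Binary.Definitions using (DecidableEquality)
import Relation.Binary.HeterogeneousEquality as H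
open H using (_≅_)
open import Relation.Binary.PropositionalEquality hiding ([_])
open import Relation.Binary.PropositionalEquality.Properties using (subst-subst-sym)
open import Relation.Nullary using (yes; no; contradiction)

module UnionFind {N X : Set} (_≟_ : DecidableEquality N) (g : N → X) where

  Link : Set
  Link = Σ (N × N) λ uv → g (proj₁ uv) ≡ g (proj₂ uv)

  record Partition : Set where
    field
      rep      : N → N
      rep-resp : ∀ x → g (rep x) ≡ g x
  open Partition public

  Identifies : Partition → Link → Set
  Identifies π ((u , v) , _) = rep π u ≡ rep π v

  relabel : (N → N) → N → N → N → N
  relabel r u v x with r x ≟ r u
  ... | yes _ = r v
  ... | no  _ = r x

  relabel-resp : ∀ r u v x y → r x ≡ r y → relabel r u v x ≡ relabel r u v y
  relabel-resp r u v x y rx≡ry with r x ≟ r u | r y ≟ r u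
  ... | yes _   | yes _   = refl
  ... | yes p   | no ¬q   = contradiction (trans (sym rx≡ry) p) ¬q
  ... | no ¬p   | yes q   = contradiction (trans rx≡ry q) ¬p
  ... | no _    | no _    = rx≡ry

  relabel-identifies : ∀ r u v → relabel r u v u ≡ relabel r u v v
  relabel-identifies r u v with r u ≟ r u | r v ≟ r u
  ... | yes _ | yes _ = refl
  ... | yes _ | no _  = refl
  ... | no ¬p | _     = contradiction refl ¬p

  merge : Partition → Link → Partition
  merge π ((u , v) , gu≡gv) = record { rep = relabel (rep π) u v ; rep-resp = relabel-resp-g }
    where
      relabel-resp-g : ∀ x → g (relabel (rep π) u v x) ≡ g x
      relabel-resp-g x with rep π x ≟ rep π u
      ... | yes p = trans (rep-resp π v) (trans (sym gu≡gv) (trans (sym (rep-resp π u)) (trans (cong g (sym p)) (rep-resp π x))))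
      ... | no _  = rep-resp π x

  merge-all : Partition → List Link → Partition
  merge-all π []       = π
  merge-all π (l ∷ ls) = merge-all (merge π l) ls

  merge-all-resp : ∀ ls π x y → rep π x ≡ rep π y → rep (merge-all π ls) x ≡ rep (merge-all π ls) y
  merge-all-resp []                 π x y e = e
  merge-all-resp (((u , v) , _) ∷ ls) π x y e = merge-all-resp ls _ x y (relabel-resp (rep π) u v x y e)

  merge-all-identifies : ∀ ls π → All (Identifies (merge-all π ls)) ls
  merge-all-identifies []                   π = []
  merge-all-identifies (((u , v) , _) ∷ ls) π =
    merge-all-resp ls _ u v (relabel-identifies (rep π) u v) ∷ merge-all-identifies ls _

  partition : List Link → Partition
  partition = merge-all (record { rep = id ; rep-resp = λ _ → refl })

  partition-identifies : ∀ ls → All (Identifies (partition ls)) ls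
  partition-identifies ls = merge-all-identifies ls _

module Chase (S : Sig) where
  open Sig S
  open Sigma S

  map-id-≗ : ∀ {X : Set} {n} {f : X → X} → f ≗ id → (xs : Vec X n) → map f xs ≡ xs
  map-id-≗ h xs = trans (map-cong h xs) (map-id xs)

  lookup-extensional : ∀ {X : Set} {n} {u v : Vec X n} → lookup u ≗ lookup v → u ≡ v
  lookup-extensional {u = u} {v} h = trans (sym (tabulate∘lookup u)) (trans (tabulate-cong h) (tabulate∘lookup v))

  xvar≡↑ʳ : ∀ m {n} (i : Fin n) → xvar m i ≡ m ↑ʳ i
  xvar≡↑ʳ zero    i = refl
  xvar≡↑ʳ (suc m) i = cong suc (xvar≡↑ʳ m i)

  lookup-++-xvar : ∀ {X : Set} {m n} (w : Vec X m) (v : Vec X n) i → lookup (w ++ᵛ v) (xvar m i) ≡ lookup v i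
  lookup-++-xvar {m = m} w v i = trans (cong (lookup (w ++ᵛ v)) (xvar≡↑ʳ m i)) (lookup-++ʳ w v i)

  ++ᶠ-xvar : ∀ {X : Set} {m n} (f : Fin m → X) (g : Fin n → X) i → (f VF.++ g) (xvar m i) ≡ g i
  ++ᶠ-xvar {m = m} f g i = trans (cong (f VF.++ g) (xvar≡↑ʳ m i)) (VFP.lookup-++ʳ f g i)

  ++ᶠ-elim : ∀ {X : Set} {m n} (P : X → Set) {f : Fin m → X} {g : Fin n → X} →
             (∀ i → P (f i)) → (∀ j → P (g j)) → ∀ k → P ((f VF.++ g) k)
  ++ᶠ-elim {m = m} P hf hg k with splitAt m k
  ... | inj₁ i = hf i
  ... | inj₂ j = hg j

  ∘-++ᶠ : ∀ {X Y : Set} {m n} (F : X → Y) (f : Fin m → X) (g : Fin n → X) k →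
          F ((f VF.++ g) k) ≡ ((F ∘ f) VF.++ (F ∘ g)) k
  ∘-++ᶠ {m = m} F f g k with splitAt m k
  ... | inj₁ i = refl
  ... | inj₂ j = refl

  ++ᶠ-suc : ∀ {X : Set} {m n} (f : Fin (suc m) → X) (g : Fin n → X) k → (f VF.++ g) (suc k) ≡ ((f ∘ suc) VF.++ g) k
  ++ᶠ-suc {m = m} f g k with splitAt m k
  ... | inj₁ i = refl
  ... | inj₂ j = refl

  data SplitView (m n : ℕ) : Fin (m + n) → Set where
    left  : (i : Fin m) → SplitView m n (i ↑ˡ n)
    right : (j : Fin n) → SplitView m n (xvar m j)

  splitView : ∀ m {n} (k : Fin (m + n)) → SplitView m n k
  splitView zero    k       = right k
  splitView (suc m) zero    = left zero
  splitView (suc m) (suc k) with splitView m k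
  ... | left i  = left (suc i)
  ... | right j = right j

  lift-cong : ∀ {m n} {ρ ρ' : Fin m → Fin n} → ρ ≗ ρ' → lift ρ ≗ lift ρ'
  lift-cong h zero    = refl
  lift-cong h (suc i) = cong suc (h i)

  ren-cong : ∀ {m n} {ρ ρ' : Fin m → Fin n} → ρ ≗ ρ' → ren ρ ≗ ren ρ'
  ren-cong h (rel R ts) = cong (rel R) (map-cong h ts)
  ren-cong h (eq i j)   = cong₂ eq (h i) (h j)
  ren-cong h ⊤          = refl
  ren-cong h (φ ∧ ψ)    = cong₂ _∧_ (ren-cong h φ) (ren-cong h ψ)
  ren-cong h (ex φ)     = cong ex (ren-cong (lift-cong h) φ)

  lift-∘ : ∀ {k m n} (ρ : Fin m → Fin n) (ρ' : Fin k → Fin m) → lift ρ ∘ lift ρ' ≗ lift (ρ ∘ ρ')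
  lift-∘ ρ ρ' zero    = refl
  lift-∘ ρ ρ' (suc i) = refl

  ren-∘ : ∀ {k m n} (ρ : Fin m → Fin n) (ρ' : Fin k → Fin m) → ren ρ ∘ ren ρ' ≗ ren (ρ ∘ ρ')
  ren-∘ ρ ρ' (rel R ts) = cong (rel R) (sym (map-∘ ρ ρ' ts))
  ren-∘ ρ ρ' (eq i j)   = refl
  ren-∘ ρ ρ' ⊤          = refl
  ren-∘ ρ ρ' (φ ∧ ψ)    = cong₂ _∧_ (ren-∘ ρ ρ' φ) (ren-∘ ρ ρ' ψ)
  ren-∘ ρ ρ' (ex φ)     = cong ex (trans (ren-∘ (lift ρ) (lift ρ') φ) (ren-cong (lift-∘ ρ ρ') φ))

  ren-id : ∀ {n} {ρ : Fin n → Fin n} → ρ ≗ id → ren ρ ≗ id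
  ren-id h (rel R ts) = cong (rel R) (map-id-≗ h ts)
  ren-id h (eq i j)   = cong₂ eq (h i) (h j)
  ren-id h ⊤          = refl
  ren-id h (φ ∧ ψ)    = cong₂ _∧_ (ren-id h φ) (ren-id h ψ)
  ren-id h (ex φ)     = cong ex (ren-id (λ { zero → refl ; (suc i) → cong suc (h i) }) φ)

  liftⁿ : ∀ m {n n'} → (Fin n → Fin n') → Fin (m + n) → Fin (m + n')
  liftⁿ zero    ρ = ρ
  liftⁿ (suc m) ρ = lift (liftⁿ m ρ)

  liftⁿ-↑ˡ : ∀ m {n n'} (ρ : Fin n → Fin n') j → liftⁿ m ρ (j ↑ˡ n) ≡ j ↑ˡ n'
  liftⁿ-↑ˡ (suc m) ρ zero    = refl
  liftⁿ-↑ˡ (suc m) ρ (suc j) = cong suc (liftⁿ-↑ˡ m ρ j)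

  liftⁿ-xvar : ∀ m {n n'} (ρ : Fin n → Fin n') i → liftⁿ m ρ (xvar m i) ≡ xvar m (ρ i)
  liftⁿ-xvar zero    ρ i = refl
  liftⁿ-xvar (suc m) ρ i = cong suc (liftⁿ-xvar m ρ i)

  ren-exs : ∀ m {n n'} (ρ : Fin n → Fin n') (φ : Fm (m + n)) → ren ρ (exs m φ) ≡ exs m (ren (liftⁿ m ρ) φ)
  ren-exs zero    ρ φ = refl
  ren-exs (suc m) ρ φ = ren-exs m ρ (ex φ)

  ⋀ : ∀ {k n} → (Fin k → Fm n) → Fm n
  ⋀ {zero}  f = ⊤
  ⋀ {suc k} f = f zero ∧ ⋀ (f ∘ suc)

  ⟦⟧-ren : ∀ {M : Str} {m n} (ρ : Fin m → Fin n) (φ : Fm m) {u : Vec (Car M) m} {v : Vec (Car M) n} →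
           (∀ i → lookup u i ≡ lookup v (ρ i)) → ⟦ φ ⟧ M u → ⟦ ren ρ φ ⟧ M v
  ⟦⟧-ren {M} ρ (rel R ts) {v = v} h s = subst (relS M R) (trans (map-cong h ts) (map-∘ (lookup v) ρ ts)) s
  ⟦⟧-ren ρ (eq i j) h s = trans (sym (h i)) (trans s (h j))
  ⟦⟧-ren ρ ⊤        h s = unit
  ⟦⟧-ren ρ (φ ∧ ψ)  h (s , t) = ⟦⟧-ren ρ φ h s , ⟦⟧-ren ρ ψ h t
  ⟦⟧-ren ρ (ex φ)   h (x , s) = x , ⟦⟧-ren (lift ρ) φ (λ { zero → refl ; (suc i) → h i }) s

  ⟦⟧-resp : ∀ {M : Str} {n} (φ : Fm n) {u v : Vec (Car M) n} → (∀ i → lookup u i ≡ lookup v i) → ⟦ φ ⟧ M u → ⟦ φ ⟧ M v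
  ⟦⟧-resp {M} φ h = subst (⟦ φ ⟧ M) (lookup-extensional h)

  ⟦exs⟧-intro : ∀ {M : Str} m {n} (φ : Fm (m + n)) (w : Vec (Car M) m) (v : Vec (Car M) n) →
                ⟦ φ ⟧ M (w ++ᵛ v) → ⟦ exs m φ ⟧ M v
  ⟦exs⟧-intro zero    φ []      v s = s
  ⟦exs⟧-intro (suc m) φ (x ∷ w) v s = ⟦exs⟧-intro m (ex φ) w v (x , s)

  ⟦conj⟧-intro : ∀ {M : Str} {n} (L : List (Atom n)) (v : Vec (Car M) n) → All (λ α → ⟦ atom α ⟧ M v) L → ⟦ conj L ⟧ M v
  ⟦conj⟧-intro []      v []       = unit
  ⟦conj⟧-intro (α ∷ L) v (s ∷ ss) = s , ⟦conj⟧-intro L v ss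

  ⟦⋀⟧-intro : ∀ {M : Str} {k n} (f : Fin k → Fm n) (v : Vec (Car M) n) → (∀ i → ⟦ f i ⟧ M v) → ⟦ ⋀ f ⟧ M v
  ⟦⋀⟧-intro {k = zero}  f v h = unit
  ⟦⋀⟧-intro {k = suc k} f v h = h zero , ⟦⋀⟧-intro (f ∘ suc) v (h ∘ suc)

  -- Blocks sz N is the context y⃗₀ … y⃗_{K-1} x⃗ with |y⃗ₖ| = sz k and |x⃗| = N.
  Blocks : ∀ {K} → (Fin K → ℕ) → ℕ → ℕ
  Blocks {zero}  sz N = N
  Blocks {suc K} sz N = sz zero + Blocks (sz ∘ suc) N

  blockVar : ∀ {K} (sz : Fin K → ℕ) {N} (k : Fin K) → Fin (sz k) → Fin (Blocks sz N)
  blockVar sz {N} zero    q = q ↑ˡ Blocks (sz ∘ suc) N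
  blockVar sz     (suc k) q = xvar (sz zero) (blockVar (sz ∘ suc) k q)

  baseVar : ∀ {K} (sz : Fin K → ℕ) {N} → Fin N → Fin (Blocks sz N)
  baseVar {zero}  sz i = i
  baseVar {suc K} sz i = xvar (sz zero) (baseVar (sz ∘ suc) i)

  concatBlocks : ∀ {K} {X : Set} (sz : Fin K → ℕ) {N} → (∀ k → Vec X (sz k)) → Vec X N → Vec X (Blocks sz N)
  concatBlocks {zero}  sz vs v = v
  concatBlocks {suc K} sz vs v = vs zero ++ᵛ concatBlocks (sz ∘ suc) (vs ∘ suc) v

  lookup-blockVar : ∀ {K} {X : Set} (sz : Fin K → ℕ) {N} (vs : ∀ k → Vec X (sz k)) (v : Vec X N) k q →
                    lookup (concatBlocks sz vs v) (blockVar sz k q) ≡ lookup (vs k) q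
  lookup-blockVar sz vs v zero    q = lookup-++ˡ (vs zero) _ q
  lookup-blockVar sz vs v (suc k) q = trans (lookup-++-xvar (vs zero) _ _) (lookup-blockVar (sz ∘ suc) (vs ∘ suc) v k q)

  lookup-baseVar : ∀ {K} {X : Set} (sz : Fin K → ℕ) {N} (vs : ∀ k → Vec X (sz k)) (v : Vec X N) i →
                   lookup (concatBlocks sz vs v) (baseVar sz i) ≡ lookup v i
  lookup-baseVar {zero}  sz vs v i = refl
  lookup-baseVar {suc K} sz vs v i = trans (lookup-++-xvar (vs zero) _ _) (lookup-baseVar (sz ∘ suc) (vs ∘ suc) v i)

  exsBlocks : ∀ {K} (sz : Fin K → ℕ) {N} → Fm (Blocks sz N) → Fm N
  exsBlocks {zero}  sz φ = φ
  exsBlocks {suc K} sz φ = exsBlocks (sz ∘ suc) (exs (sz zero) φ)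

  ⟦exsBlocks⟧-intro : ∀ {M : Str} {K} (sz : Fin K → ℕ) {N} (φ : Fm (Blocks sz N)) (vs : ∀ k → Vec (Car M) (sz k))
                      (v : Vec (Car M) N) → ⟦ φ ⟧ M (concatBlocks sz vs v) → ⟦ exsBlocks sz φ ⟧ M v
  ⟦exsBlocks⟧-intro {K = zero}  sz φ vs v s = s
  ⟦exsBlocks⟧-intro {K = suc K} sz φ vs v s =
    ⟦exsBlocks⟧-intro (sz ∘ suc) (exs (sz zero) φ) (vs ∘ suc) v (⟦exs⟧-intro (sz zero) φ (vs zero) _ s)

  module Derivations (Γ : Seqs) where

    infix 4 _⊢_
    _⊢_ : ∀ {n} → Fm n → Fm n → Set
    _⊢_ = Der Γ

    ∃-intro : ∀ {n} (i : Fin n) (φ : Fm (suc n)) → ren (σ i) φ ⊢ ex φ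
    ∃-intro i φ = subst (ren (σ i) φ ⊢_) σ∘suc (rename (σ i) (∃-up idty))
      where σ∘suc : ren (σ i) (wk (ex φ)) ≡ ex φ
            σ∘suc = trans (ren-∘ (σ i) suc (ex φ)) (ren-id (λ _ → refl) (ex φ))

    exs-elim : ∀ m {n} {φ : Fm (m + n)} {ψ : Fm n} → φ ⊢ ren (xvar m) ψ → exs m φ ⊢ ψ
    exs-elim zero    {φ = φ} d = subst (φ ⊢_) (ren-id (λ _ → refl) _) d
    exs-elim (suc m) {φ = φ} {ψ} d = exs-elim m (∃-down (subst (φ ⊢_) (sym (ren-∘ suc (xvar m) ψ)) d))

    exsBlocks-elim : ∀ {K} (sz : Fin K → ℕ) {N} {φ : Fm (Blocks sz N)} {ψ : Fm N} → φ ⊢ ren (baseVar sz) ψ → exsBlocks sz φ ⊢ ψ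
    exsBlocks-elim {zero}  sz {φ = φ} d = subst (φ ⊢_) (ren-id (λ _ → refl) _) d
    exsBlocks-elim {suc K} sz {φ = φ} {ψ} d =
      exsBlocks-elim (sz ∘ suc) (exs-elim (sz zero) (subst (φ ⊢_) (sym (ren-∘ (xvar (sz zero)) (baseVar (sz ∘ suc)) ψ)) d))

    ex-mono : ∀ {n} {φ ψ : Fm (suc n)} → φ ⊢ ψ → ex φ ⊢ ex ψ
    ex-mono d = ∃-down (cut d (∃-up idty))

    exs-mono : ∀ m {n} {φ ψ : Fm (m + n)} → φ ⊢ ψ → exs m φ ⊢ exs m ψ
    exs-mono zero    d = d
    exs-mono (suc m) d = exs-mono m (ex-mono d)

    frobeniusⁿ : ∀ m {n} {χ : Fm n} {φ : Fm (m + n)} → χ ∧ exs m φ ⊢ exs m (ren (xvar m) χ ∧ φ)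
    frobeniusⁿ zero    {χ = χ} {φ} = subst (λ χ' → χ ∧ φ ⊢ χ' ∧ φ) (sym (ren-id (λ _ → refl) χ)) idty
    frobeniusⁿ (suc m) {χ = χ} {φ} =
      cut (frobeniusⁿ m)
          (exs-mono m (subst (λ χ' → ren (xvar m) χ ∧ ex φ ⊢ ex (χ' ∧ φ)) (ren-∘ suc (xvar m) χ) frobenius))

    ∧-proj₁ : ∀ {n} {χ φ ψ : Fm n} → χ ⊢ φ ∧ ψ → χ ⊢ φ
    ∧-proj₁ d = cut d ∧-elimˡ

    ∧-proj₂ : ∀ {n} {χ φ ψ : Fm n} → χ ⊢ φ ∧ ψ → χ ⊢ ψ
    ∧-proj₂ d = cut d ∧-elimʳ

    ⋀-elim : ∀ {k n} (f : Fin k → Fm n) i → ⋀ f ⊢ f i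
    ⋀-elim f zero    = ∧-elimˡ
    ⋀-elim f (suc i) = cut ∧-elimʳ (⋀-elim (f ∘ suc) i)

    conj-elim : ∀ {n} {α : Atom n} {L : List (Atom n)} → α ∈ L → conj L ⊢ atom α
    conj-elim (here refl) = ∧-elimˡ
    conj-elim (there α∈L) = cut ∧-elimʳ (conj-elim α∈L)

    eq-refl′ : ∀ {n} {χ : Fm n} i → χ ⊢ eq i i
    eq-refl′ i = cut ⊤-intro (eq-refl i)

    eq-subst′ : ∀ {n} {χ : Fm n} (φ : Fm (suc n)) {i j} → χ ⊢ eq i j → χ ⊢ ren (σ i) φ → χ ⊢ ren (σ j) φ
    eq-subst′ φ {i} {j} d₁ d₂ = cut (∧-intro d₁ d₂) (eq-subst φ i j)

    eq-sym′ : ∀ {n} {χ : Fm n} {i j} → χ ⊢ eq i j → χ ⊢ eq j i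
    eq-sym′ {i = i} d = eq-subst′ (eq zero (suc i)) d (eq-refl′ i)

    eq-substⁿ : ∀ a {n} {χ : Fm n} (φ : Fm (a + n)) (ρ ρ' : Fin a → Fin n) →
                (∀ q → χ ⊢ eq (ρ q) (ρ' q)) → χ ⊢ ren (ρ VF.++ id) φ → χ ⊢ ren (ρ' VF.++ id) φ
    eq-substⁿ zero    φ ρ ρ' h d = d
    eq-substⁿ (suc a) {n} {χ} φ ρ ρ' h d =
      subst (χ ⊢_) last (eq-substⁿ a φ₂ (ρ ∘ suc) (ρ' ∘ suc) (h ∘ suc) (subst (χ ⊢_) middle first))
      where
        g : Fin (a + n) → Fin n
        g = (ρ ∘ suc) VF.++ id
        φ₁ : Fm (suc n)
        φ₁ = ren (lift g) φ
        θ : Fin (suc (a + n)) → Fin (a + n)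
        θ zero    = xvar a (ρ' zero)
        θ (suc k) = k
        φ₂ : Fm (a + n)
        φ₂ = ren θ φ
        first : χ ⊢ ren (σ (ρ' zero)) φ₁
        first = eq-subst′ φ₁ (h zero)
          (subst (χ ⊢_) (trans (ren-cong (λ { zero → refl ; (suc k) → ++ᶠ-suc ρ id k }) φ)
                               (sym (ren-∘ (σ (ρ zero)) (lift g) φ))) d)
        middle : ren (σ (ρ' zero)) φ₁ ≡ ren g φ₂
        middle = trans (ren-∘ (σ (ρ' zero)) (lift g) φ)
                   (trans (ren-cong (λ { zero → sym (++ᶠ-xvar (ρ ∘ suc) id (ρ' zero)) ; (suc k) → refl }) φ)
                          (sym (ren-∘ g θ φ)))
        last : ren ((ρ' ∘ suc) VF.++ id) φ₂ ≡ ren (ρ' VF.++ id) φ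
        last = trans (ren-∘ ((ρ' ∘ suc) VF.++ id) θ φ)
                 (ren-cong (λ { zero → ++ᶠ-xvar (ρ' ∘ suc) id (ρ' zero) ; (suc k) → sym (++ᶠ-suc ρ' id k) }) φ)

    rel-cong : ∀ {n} {χ : Fm n} {R} {ks ks' : Vec (Fin n) (ar R)} → χ ⊢ rel R ks →
               (∀ i → χ ⊢ eq (lookup ks i) (lookup ks' i)) → χ ⊢ rel R ks'
    rel-cong {n} {χ} {R} {ks} {ks'} d h =
      subst (χ ⊢_) (as-ren ks') (eq-substⁿ (ar R) template (lookup ks) (lookup ks') h (subst (χ ⊢_) (sym (as-ren ks)) d))
      where
        template : Fm (ar R + n)
        template = rel R (tabulate (_↑ˡ n))
        as-ren : (xs : Vec (Fin n) (ar R)) → ren (lookup xs VF.++ id) template ≡ rel R xs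
        as-ren xs = cong (rel R) (lookup-extensional λ i →
          trans (lookup-map i _ (tabulate (_↑ˡ n)))
                (trans (cong (lookup xs VF.++ id) (lookup∘tabulate (_↑ˡ n) i)) (VFP.lookup-++ˡ (lookup xs) id i)))

  module Chasing (T : Theory) where
    open Derivations (axSeqs T) public

    fired : ∀ {G} (τ : Ax T) → (Fin (nx T τ) → Fin G) → Fm G → Fm (ny T τ + G)
    fired τ ρ χ = ren (xvar (ny T τ)) χ ∧ ren (liftⁿ (ny T τ) ρ) (conj (post T τ))

    apply-axiom : ∀ {G} {χ goal : Fm G} (τ : Ax T) (ρ : Fin (nx T τ) → Fin G) → χ ⊢ ren ρ (conj (pre T τ)) →
                  fired τ ρ χ ⊢ ren (xvar (ny T τ)) goal → χ ⊢ goal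
    apply-axiom τ ρ ⊢pre ⊢goal = cut (∧-intro idty (cut ⊢pre axiom′)) (cut (frobeniusⁿ (ny T τ)) (exs-elim (ny T τ) ⊢goal))
      where axiom′ : ren ρ (conj (pre T τ)) ⊢ exs (ny T τ) (ren (liftⁿ (ny T τ) ρ) (conj (post T τ)))
            axiom′ = subst (ren ρ (conj (pre T τ)) ⊢_) (ren-exs (ny T τ) ρ (conj (post T τ))) (rename ρ (axiom τ))

    -- An instance is optional (nothing: no axiom is fired there); arityʸ counts its witnesses.
    arityʸ : Maybe (Ax T) → ℕ
    arityʸ nothing  = 0
    arityʸ (just τ) = ny T τ

    castʸ : ∀ {x τ} → x ≡ just τ → Fin (ny T τ) → Fin (arityʸ x)
    castʸ e = subst (λ x → Fin (arityʸ x)) (sym e)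

    same-instance : ∀ {x : Maybe (Ax T)} {τ₁ τ₂} (e₁ : x ≡ just τ₁) (e₂ : x ≡ just τ₂) (P : ∀ τ → x ≡ just τ → Set) →
                    P τ₁ e₁ → P τ₂ e₂
    same-instance refl refl P p = p

    Arguments : ∀ {K} → (Fin K → Maybe (Ax T)) → ℕ → Set
    Arguments J G = ∀ k {τ} → J k ≡ just τ → Fin (nx T τ) → Fin G

    -- Sufficient for χ ⊢ goal: goal is derivable in every extension E of the context in which
    -- every instance k has been fired, with witnesses yv k.
    Chased : ∀ {K G} (J : Fin K → Maybe (Ax T)) → Arguments J G → Fm G → Fm G → Set
    Chased {K} {G} J ρs χ goal =
      ∀ {G'} (E : Fin G → Fin G') (yv : ∀ k → Fin (arityʸ (J k)) → Fin G') (χ' : Fm G') → χ' ⊢ ren E χ →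
      (∀ k {τ} (e : J k ≡ just τ) → χ' ⊢ ren ((yv k ∘ castʸ e) VF.++ (E ∘ ρs k e)) (conj (post T τ))) →
      χ' ⊢ ren E goal

    chased-skip : ∀ {K G} {J : Fin (suc K) → Maybe (Ax T)} {ρs : Arguments J G} {χ goal : Fm G} →
                  J zero ≡ nothing → Chased J ρs χ goal → Chased (J ∘ suc) (λ k → ρs (suc k)) χ goal
    chased-skip {J = J} {ρs} J₀≡nothing chased E yv χ' ⊢χ ⊢post = chased E yv′ χ' ⊢χ post′
      where
        yv′ : ∀ k → Fin (arityʸ (J k)) → Fin _
        yv′ zero q    = ⊥-elim (¬Fin0 (subst (λ x → Fin (arityʸ x)) J₀≡nothing q))
        yv′ (suc k) = yv k
        post′ : ∀ k {τ} (e : J k ≡ just τ) → χ' ⊢ ren ((yv′ k ∘ castʸ e) VF.++ (E ∘ ρs k e)) (conj (post T τ))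
        post′ zero    e with () ← trans (sym J₀≡nothing) e
        post′ (suc k) e = ⊢post k e

    chased-fire : ∀ {K G} {J : Fin (suc K) → Maybe (Ax T)} {ρs : Arguments J G} {χ goal : Fm G} {τ₀} (J₀≡τ₀ : J zero ≡ just τ₀) →
                  Chased J ρs χ goal →
                  Chased (J ∘ suc) (λ k e → xvar (ny T τ₀) ∘ ρs (suc k) e) (fired τ₀ (ρs zero J₀≡τ₀) χ) (ren (xvar (ny T τ₀)) goal)
    chased-fire {J = J} {ρs} {χ} {goal} {τ₀} J₀≡τ₀ chased E yv χ' ⊢χ₁ ⊢post =
      subst (χ' ⊢_) (sym (ren-∘ E (xvar y₀) goal))
        (chased (E ∘ xvar y₀) yv′ χ' (subst (χ' ⊢_) (ren-∘ E (xvar y₀) χ) (∧-proj₁ ⊢χ₁)) post′)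
      where
        y₀ : ℕ
        y₀ = ny T τ₀
        ρ₀ : Fin (nx T τ₀) → Fin _
        ρ₀ = ρs zero J₀≡τ₀
        yv′ : ∀ k → Fin (arityʸ (J k)) → Fin _
        yv′ zero q    = E (subst (λ x → Fin (arityʸ x)) J₀≡τ₀ q ↑ˡ _)
        yv′ (suc k) = yv k
        post₀ : ∀ q → E (liftⁿ y₀ ρ₀ q) ≡ ((yv′ zero ∘ castʸ J₀≡τ₀) VF.++ (E ∘ xvar y₀ ∘ ρ₀)) q
        post₀ q with splitView y₀ q
        ... | left j  = trans (cong E (liftⁿ-↑ˡ y₀ ρ₀ j))
                          (sym (trans (VFP.lookup-++ˡ (yv′ zero ∘ castʸ J₀≡τ₀) _ j)
                                      (cong (λ j′ → E (j′ ↑ˡ _)) (subst-subst-sym {P = λ x → Fin (arityʸ x)} J₀≡τ₀))))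
        ... | right i = trans (cong E (liftⁿ-xvar y₀ ρ₀ i)) (sym (++ᶠ-xvar (yv′ zero ∘ castʸ J₀≡τ₀) (E ∘ xvar y₀ ∘ ρ₀) i))
        post′ : ∀ k {τ} (e : J k ≡ just τ) → χ' ⊢ ren ((yv′ k ∘ castʸ e) VF.++ (E ∘ xvar y₀ ∘ ρs k e)) (conj (post T τ))
        post′ (suc k) e = ⊢post k e
        post′ zero    e =
          same-instance J₀≡τ₀ e (λ τ e′ → χ' ⊢ ren ((yv′ zero ∘ castʸ e′) VF.++ (E ∘ xvar y₀ ∘ ρs zero e′)) (conj (post T τ)))
            (subst (χ' ⊢_) (trans (ren-∘ E (liftⁿ y₀ ρ₀) (conj (post T τ₀))) (ren-cong post₀ (conj (post T τ₀))))
                   (∧-proj₂ ⊢χ₁))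

    chase-instances : ∀ K {G} (J : Fin K → Maybe (Ax T)) (ρs : Arguments J G) {χ goal : Fm G} →
                      (∀ k {τ} (e : J k ≡ just τ) → χ ⊢ ren (ρs k e) (conj (pre T τ))) →
                      Chased J ρs χ goal → χ ⊢ goal
    chase-instances zero J ρs {χ} {goal} ⊢pre chased =
      subst (χ ⊢_) (ren-id (λ _ → refl) goal)
        (chased id (λ ()) χ (subst (χ ⊢_) (sym (ren-id (λ _ → refl) χ)) idty) (λ ()))
    chase-instances (suc K) J ρs {χ} ⊢pre chased with J zero in J₀
    ... | nothing = chase-instances K (J ∘ suc) (λ k → ρs (suc k)) (λ k → ⊢pre (suc k)) (chased-skip J₀ chased)
    ... | just τ₀ = apply-axiom τ₀ (ρs zero J₀) (⊢pre zero J₀)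
          (chase-instances K (J ∘ suc) (λ k e → xvar y₀ ∘ ρs (suc k) e) ⊢pre′ (chased-fire J₀ chased))
      where
        y₀ : ℕ
        y₀ = ny T τ₀
        ⊢pre′ : ∀ k {τ} (e : J (suc k) ≡ just τ) → fired τ₀ (ρs zero J₀) χ ⊢ ren (xvar y₀ ∘ ρs (suc k) e) (conj (pre T τ))
        ⊢pre′ k e = subst (_ ⊢_) (ren-∘ (xvar y₀) (ρs (suc k) e) _) (cut ∧-elimˡ (rename (xvar y₀) (⊢pre (suc k) e)))

  -- Flattening: ∃z⃗ (⋀ occ ∧ ⋀ equation), with bound variables z⃗ (inj₁) and free ones (inj₂)

  Term : ℕ → ℕ → Set
  Term m n = Fin m ⊎ Fin n

  value : ∀ {X : Set} {m n} → Vec X m → Vec X n → Term m n → X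
  value w v = [ lookup w , lookup v ]′

  record Flat (m n : ℕ) : Set where
    field
      #rels #eqs : ℕ
      occ      : Fin #rels → Σ Rel λ R → Vec (Term m n) (ar R)
      equation : Fin #eqs → Term m n × Term m n
  open Flat public

  renameᶠ : ∀ {m n m' n'} → (Term m n → Term m' n') → Flat m n → Flat m' n'
  renameᶠ f P = record { occ = Product.map₂ (map f) ∘ occ P ; equation = Product.map f f ∘ equation P }

  _⊗_ : ∀ {m n} → Flat m n → Flat m n → Flat m n
  P ⊗ Q = record { occ = occ P VF.++ occ Q ; equation = equation P VF.++ equation Q }

  Holds : (M : Str) {m n : ℕ} → Flat m n → Vec (Car M) m → Vec (Car M) n → Set
  Holds M P w v = (∀ k → relS M (proj₁ (occ P k)) (map (value w v) (proj₂ (occ P k)))) ×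
                  (∀ k → value w v (proj₁ (equation P k)) ≡ value w v (proj₂ (equation P k)))

  holds-rename : ∀ {M : Str} {m n m' n'} (f : Term m n → Term m' n') (P : Flat m n) {w v w' v'} →
                 (∀ t → value w' v' (f t) ≡ value w v t) → Holds M P w v → Holds M (renameᶠ f P) w' v'
  holds-rename {M} f P {w' = w'} {v'} h (⊨occ , ⊨eq) =
    (λ k → subst (relS M _) (trans (sym (map-cong h _)) (map-∘ (value w' v') f _)) (⊨occ k)) ,
    (λ k → trans (h _) (trans (⊨eq k) (sym (h _))))

  holds-⊗ : ∀ {M : Str} {m n} (P Q : Flat m n) {w v} → Holds M P w v → Holds M Q w v → Holds M (P ⊗ Q) w v
  holds-⊗ {M} P Q {w} {v} (⊨occP , ⊨eqP) (⊨occQ , ⊨eqQ) =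
    ++ᶠ-elim (λ o → relS M (proj₁ o) (map (value w v) (proj₂ o))) ⊨occP ⊨occQ ,
    ++ᶠ-elim (λ e → value w v (proj₁ e) ≡ value w v (proj₂ e)) ⊨eqP ⊨eqQ

  module Flattening (Γ : Seqs) where
    open Derivations Γ

    Derives : ∀ {G m n} → Fm G → (Term m n → Fin G) → Flat m n → Set
    Derives χ h P = (∀ k → χ ⊢ rel (proj₁ (occ P k)) (map h (proj₂ (occ P k)))) ×
                    (∀ k → χ ⊢ eq (h (proj₁ (equation P k))) (h (proj₂ (equation P k))))

    derives-rename : ∀ {G m n m' n'} {χ : Fm G} {h : Term m' n' → Fin G} (f : Term m n → Term m' n') (P : Flat m n) →
                     Derives χ h (renameᶠ f P) → Derives χ (h ∘ f) P
    derives-rename {χ = χ} {h} f P (⊢occ , ⊢eq) =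
      (λ k → subst (λ ts → χ ⊢ rel _ ts) (sym (map-∘ h f (proj₂ (occ P k)))) (⊢occ k)) , ⊢eq

    derives-⊗ : ∀ {G m n} {χ : Fm G} {h : Term m n → Fin G} (P Q : Flat m n) → Derives χ h (P ⊗ Q) → Derives χ h P × Derives χ h Q
    derives-⊗ {m = m} {n} {χ} {h} P Q (⊢occ , ⊢eq) =
      ((λ k → subst occ-⊢ (VFP.lookup-++ˡ (occ P) (occ Q) k) (⊢occ (k ↑ˡ _))) ,
       (λ k → subst eq-⊢ (VFP.lookup-++ˡ (equation P) (equation Q) k) (⊢eq (k ↑ˡ _)))) ,
      ((λ k → subst occ-⊢ (VFP.lookup-++ʳ (occ P) (occ Q) k) (⊢occ (#rels P ↑ʳ k))) ,
       (λ k → subst eq-⊢ (VFP.lookup-++ʳ (equation P) (equation Q) k) (⊢eq (#eqs P ↑ʳ k))))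
      where
        occ-⊢ : (Σ Rel λ R → Vec (Term m n) (ar R)) → Set
        occ-⊢ (R , ts) = χ ⊢ rel R (map h ts)
        eq-⊢ : Term m n × Term m n → Set
        eq-⊢ (z₁ , z₂) = χ ⊢ eq (h z₁) (h z₂)

    -- Quantifying over every instantiation h makes entailment survive renaming into larger contexts.
    Entails : ∀ {m n} → Flat m n → Fm n → Set
    Entails {m} {n} P φ = ∀ {G} (χ : Fm G) (h : Term m n → Fin G) → Derives χ h P → χ ⊢ ren (h ∘ inj₂) φ

    record Flattened (M : Str) {n : ℕ} (φ : Fm n) (v : Vec (Car M) n) : Set where
      field
        #vars   : ℕ
        flat    : Flat #vars n
        witness : Vec (Car M) #vars
        holds   : Holds M flat witness v
        entails : Entails flat φ

    flatten : ∀ {M : Str} {n} (φ : Fm n) (v : Vec (Car M) n) → ⟦ φ ⟧ M v → Flattened M φ v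
    flatten {M} (rel R ts) v s = record
      { #vars = 0 ; flat = record { #rels = 1 ; #eqs = 0 ; occ = λ _ → R , map inj₂ ts ; equation = λ () } ; witness = []
      ; holds = (λ { zero → subst (relS M R) (map-∘ (value [] v) inj₂ ts) s }) , (λ ())
      ; entails = λ χ h (⊢occ , _) → subst (λ ts′ → χ ⊢ rel R ts′) (sym (map-∘ h inj₂ ts)) (⊢occ zero) }
    flatten (eq i j) v s = record
      { #vars = 0 ; flat = record { #rels = 0 ; #eqs = 1 ; occ = λ () ; equation = λ _ → inj₂ i , inj₂ j } ; witness = []
      ; holds = (λ ()) , (λ { zero → s }) ; entails = λ χ h (_ , ⊢eq) → ⊢eq zero }
    flatten ⊤ v s = record
      { #vars = 0 ; flat = record { #rels = 0 ; #eqs = 0 ; occ = λ () ; equation = λ () } ; witness = []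
      ; holds = (λ ()) , (λ ()) ; entails = λ _ _ _ → ⊤-intro }
    flatten {M} {n} (φ₁ ∧ φ₂) v (s₁ , s₂) = record
      { #vars = F₁.#vars + F₂.#vars ; flat = P ; witness = F₁.witness ++ᵛ F₂.witness
      ; holds = holds-⊗ {M} P₁ P₂ {F₁.witness ++ᵛ F₂.witness} {v}
                  (holds-rename {M} f₁ F₁.flat {F₁.witness} {v} {F₁.witness ++ᵛ F₂.witness} {v} value₁ F₁.holds)
                                 (holds-rename {M} f₂ F₂.flat {F₂.witness} {v} {F₁.witness ++ᵛ F₂.witness} {v} value₂ F₂.holds)
      ; entails = λ χ h ⊢P → let (⊢P₁ , ⊢P₂) = derives-⊗ P₁ P₂ ⊢P in
                  ∧-intro (F₁.entails χ (h ∘ f₁) (derives-rename f₁ F₁.flat ⊢P₁))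
                          (F₂.entails χ (h ∘ f₂) (derives-rename f₂ F₂.flat ⊢P₂)) }
      where
        module F₁ = Flattened (flatten φ₁ v s₁)
        module F₂ = Flattened (flatten φ₂ v s₂)
        f₁ : Term F₁.#vars n → Term (F₁.#vars + F₂.#vars) n
        f₁ = Sum.map (_↑ˡ F₂.#vars) id
        f₂ : Term F₂.#vars n → Term (F₁.#vars + F₂.#vars) n
        f₂ = Sum.map (F₁.#vars ↑ʳ_) id
        P₁ P₂ P : Flat (F₁.#vars + F₂.#vars) n
        P₁ = renameᶠ f₁ F₁.flat
        P₂ = renameᶠ f₂ F₂.flat
        P = P₁ ⊗ P₂
        value₁ : ∀ t → value (F₁.witness ++ᵛ F₂.witness) v (f₁ t) ≡ value F₁.witness v t
        value₁ (inj₁ i) = lookup-++ˡ F₁.witness F₂.witness i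
        value₁ (inj₂ i) = refl
        value₂ : ∀ t → value (F₁.witness ++ᵛ F₂.witness) v (f₂ t) ≡ value F₂.witness v t
        value₂ (inj₁ i) = lookup-++ʳ F₁.witness F₂.witness i
        value₂ (inj₂ i) = refl
    flatten {M} {n} (ex φ) v (x , s) = record
      { #vars = suc F.#vars ; flat = renameᶠ bind F.flat ; witness = x ∷ F.witness
      ; holds = holds-rename {M} bind F.flat {F.witness} {x ∷ v} {x ∷ F.witness} {v} value-bind F.holds
      ; entails = λ χ h ⊢P →
          cut (subst (χ ⊢_) (ren-via-σ h) (F.entails χ (h ∘ bind) (derives-rename bind F.flat ⊢P)))
              (∃-intro (h (inj₁ zero)) (ren (lift (h ∘ inj₂)) φ)) }
      where
        module F = Flattened (flatten φ (x ∷ v) s)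
        bind : Term F.#vars (suc n) → Term (suc F.#vars) n
        bind (inj₁ i)       = inj₁ (suc i)
        bind (inj₂ zero)    = inj₁ zero
        bind (inj₂ (suc j)) = inj₂ j
        value-bind : ∀ t → value (x ∷ F.witness) v (bind t) ≡ value F.witness (x ∷ v) t
        value-bind (inj₁ i)       = refl
        value-bind (inj₂ zero)    = refl
        value-bind (inj₂ (suc j)) = refl
        ren-via-σ : ∀ {G} (h : Term (suc F.#vars) n → Fin G) →
                    ren (h ∘ bind ∘ inj₂) φ ≡ ren (σ (h (inj₁ zero))) (ren (lift (h ∘ inj₂)) φ)
        ren-via-σ h = sym (trans (ren-∘ _ _ φ) (ren-cong (λ { zero → refl ; (suc j) → refl }) φ))

  module OneStepConservative (T : Theory) where
    open Chasing T
    open Flattening (axSeqs T)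
    open OneStep T

    Trigger : Str → Set
    Trigger B = Σ (Ax T) λ τ → Σ (Vec (Car B) (nx T τ)) λ a → ⟦ conj (pre T τ) ⟧ B a

    axiomOf : ∀ {B} → Maybe (Trigger B) → Maybe (Ax T)
    axiomOf = Maybe.map proj₁

    triggerᵉ : ∀ {B} → T1Car B → Maybe (Trigger B)
    triggerᵉ (inj₁ _)               = nothing
    triggerᵉ (inj₂ (τ , a , p , _)) = just (τ , a , p)

    triggerʳ : ∀ {B R c} → T1Rel B R c → Maybe (Trigger B)
    triggerʳ (old _ _ _)   = nothing
    triggerʳ (new τ a p _) = just (τ , a , p)

    #argsᵉ : ∀ {B} → T1Car B → ℕ
    #argsᵉ (inj₁ _)       = 1
    #argsᵉ (inj₂ (τ , _)) = nx T τ

    argsᵉ : ∀ {B} (x : T1Car B) → Vec (Car B) (#argsᵉ x)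
    argsᵉ (inj₁ c)               = c ∷ []
    argsᵉ (inj₂ (τ , a , p , j)) = a

    #argsʳ : ∀ {B R c} → T1Rel B R c → ℕ
    #argsʳ (old _ _ _)   = 0
    #argsʳ (new τ _ _ _) = nx T τ

    argsʳ : ∀ {B R c} (x : T1Rel B R c) → Vec (Car B) (#argsʳ x)
    argsʳ (old _ _ _)   = []
    argsʳ (new τ a _ _) = a

    castᵉ : ∀ {B} (x : T1Car B) {τ} → axiomOf (triggerᵉ x) ≡ just τ → Fin (nx T τ) → Fin (#argsᵉ x)
    castᵉ (inj₂ _) refl q = q

    castʳ : ∀ {B R c} (x : T1Rel B R c) {τ} → axiomOf (triggerʳ x) ≡ just τ → Fin (nx T τ) → Fin (#argsʳ x)
    castʳ (new _ _ _ _) refl q = q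

    lookup-castᵉ : ∀ {B} (x : T1Car B) {t : Trigger B} → triggerᵉ x ≡ just t → (e : axiomOf (triggerᵉ x) ≡ just (proj₁ t)) →
                   ∀ q → lookup (argsᵉ x) (castᵉ x e q) ≡ lookup (proj₁ (proj₂ t)) q
    lookup-castᵉ (inj₂ _) refl refl q = refl

    lookup-castʳ : ∀ {B R c} (x : T1Rel B R c) {t : Trigger B} → triggerʳ x ≡ just t → (e : axiomOf (triggerʳ x) ≡ just (proj₁ t)) →
                   ∀ q → lookup (argsʳ x) (castʳ x e q) ≡ lookup (proj₁ (proj₂ t)) q
    lookup-castʳ (new _ _ _ _) refl refl q = refl

    inj₁-fiber-unique : ∀ {A C : Set} {x : A ⊎ C} {y y'} (e : x ≡ inj₁ y) (e' : x ≡ inj₁ y') →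
                        _≡_ {A = Σ A λ y → x ≡ inj₁ y} (y , e) (y' , e')
    inj₁-fiber-unique refl refl = refl

    inj₂-fiber-unique : ∀ {A C : Set} {x : A ⊎ C} {y y'} (e : x ≡ inj₂ y) (e' : x ≡ inj₂ y') →
                        _≡_ {A = Σ C λ y → x ≡ inj₂ y} (y , e) (y' , e')
    inj₂-fiber-unique refl refl = refl

    oldPos : ∀ {B} (x : T1Car B) {c} → x ≡ inj₁ c → Fin (#argsᵉ x)
    oldPos (inj₁ _) _ = zero

    lookup-oldPos : ∀ {B} (x : T1Car B) {c} (e : x ≡ inj₁ c) → lookup (argsᵉ x) (oldPos x e) ≡ c
    lookup-oldPos (inj₁ _) refl = refl

    inj₁≢inj₂ : ∀ {A C : Set} {x : A} {y : C} → inj₁ x ≢ inj₂ y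
    inj₁≢inj₂ ()

    contribution : ∀ {X : Set} {k} {u : Vec X k} {R c} {L : List (Atom k)} → Any (λ α → Contrib u α R c) L →
                   Σ (Vec (Fin k) (ar R)) λ ts → (ratom R ts ∈ L) × (c ≡ map (lookup u) ts)
    contribution (here (mk e)) = _ , here refl , e
    contribution (there c) = let (ts , ∈L , e) = contribution c in ts , there ∈L , e

    lookup-val-witness : ∀ B τ a p j → lookup (val B τ a p) (j ↑ˡ nx T τ) ≡ inj₂ (τ , a , p , j)
    lookup-val-witness B τ a p j = trans (lookup-++ˡ (tabulate (λ j → inj₂ (τ , a , p , j))) (map inj₁ a) j) (lookup∘tabulate _ j)

    lookup-val-argument : ∀ B τ a p q → lookup (val B τ a p) (xvar (ny T τ) q) ≡ inj₁ (lookup a q)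
    lookup-val-argument B τ a p q =
      trans (lookup-++-xvar (tabulate (λ j → inj₂ (τ , a , p , j))) (map inj₁ a) q) (lookup-map q inj₁ a)

    elemAt : ∀ {B : Str} {m n} → Vec (T1Car B) m → Vec (Car B) n → Term m n → T1Car B
    elemAt w b (inj₁ i) = lookup w i
    elemAt w b (inj₂ i) = inj₁ (lookup b i)

    module Construction (B : Str) {m n} (b : Vec (Car B) n) (P : Flat m n) (w : Vec (T1Car B) m)
        (⊨occ : ∀ k → T1Rel B (proj₁ (occ P k)) (map (elemAt w b) (proj₂ (occ P k))))
        (⊨eq  : ∀ k → elemAt w b (proj₁ (equation P k)) ≡ elemAt w b (proj₂ (equation P k))) where

      r : ℕ
      r = #rels P

      elem : Term m n → T1Car B
      elem = elemAt w b

      relAt : Fin r → Rel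
      relAt k = proj₁ (occ P k)

      termsAt : (k : Fin r) → Vec (Term m n) (ar (relAt k))
      termsAt k = proj₂ (occ P k)

      eqLhs eqRhs : Fin (#eqs P) → Term m n
      eqLhs k = proj₁ (equation P k)
      eqRhs k = proj₂ (equation P k)

      Node : Set
      Node = Fin m ⊎ Fin r

      triggerN : Node → Maybe (Trigger B)
      triggerN (inj₁ i) = triggerᵉ (lookup w i)
      triggerN (inj₂ k) = triggerʳ (⊨occ k)

      axiomN : Node → Maybe (Ax T)
      axiomN nd = axiomOf (triggerN nd)

      -- Γ has a block per variable (its value if old, the arguments a⃗ of its trigger if new), a block
      -- per fact (the trigger arguments if new, empty if old), and then the free variables.
      #argsV : Fin m → ℕ
      #argsV i = #argsᵉ (lookup w i)

      #argsR : Fin r → ℕ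
      #argsR k = #argsʳ (⊨occ k)

      Γ : ℕ
      Γ = Blocks #argsV (Blocks #argsR n)

      #argsN : Node → ℕ
      #argsN (inj₁ i) = #argsV i
      #argsN (inj₂ k) = #argsR k

      argVar : (nd : Node) → Fin (#argsN nd) → Fin Γ
      argVar (inj₁ i) = blockVar #argsV i
      argVar (inj₂ k) = baseVar #argsV ∘ blockVar #argsR k

      freeVar : Fin n → Fin Γ
      freeVar = baseVar #argsV ∘ baseVar #argsR

      valuation : Vec (Car B) Γ
      valuation = concatBlocks #argsV (λ i → argsᵉ (lookup w i)) (concatBlocks #argsR (λ k → argsʳ (⊨occ k)) b)

      argsN : (nd : Node) → Vec (Car B) (#argsN nd)
      argsN (inj₁ i) = argsᵉ (lookup w i)
      argsN (inj₂ k) = argsʳ (⊨occ k)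

      lookup-argVar : ∀ nd q → lookup valuation (argVar nd q) ≡ lookup (argsN nd) q
      lookup-argVar (inj₁ i) q = lookup-blockVar #argsV _ _ i q
      lookup-argVar (inj₂ k) q = trans (lookup-baseVar #argsV _ _ (blockVar #argsR k q)) (lookup-blockVar #argsR _ _ k q)

      lookup-freeVar : ∀ i → lookup valuation (freeVar i) ≡ lookup b i
      lookup-freeVar i = trans (lookup-baseVar #argsV _ _ (baseVar #argsR i)) (lookup-baseVar #argsR _ _ i)

      premiseArgs : ∀ nd {τ} → axiomN nd ≡ just τ → Fin (nx T τ) → Fin Γ
      premiseArgs (inj₁ i) e q = argVar (inj₁ i) (castᵉ (lookup w i) e q)
      premiseArgs (inj₂ k) e q = argVar (inj₂ k) (castʳ (⊨occ k) e q)

      lookup-premiseArgs : ∀ nd {t} → triggerN nd ≡ just t → (e : axiomN nd ≡ just (proj₁ t)) → ∀ q →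
                           lookup valuation (premiseArgs nd e q) ≡ lookup (proj₁ (proj₂ t)) q
      lookup-premiseArgs (inj₁ i) et e q = trans (lookup-argVar (inj₁ i) _) (lookup-castᵉ (lookup w i) et e q)
      lookup-premiseArgs (inj₂ k) et e q = trans (lookup-argVar (inj₂ k) _) (lookup-castʳ (⊨occ k) et e q)

      data Kind : Term m n → Set where
        old : ∀ {z} (c : Car B) → elem z ≡ inj₁ c → Kind z
        new : (i : Fin m) (x : New B) → lookup w i ≡ inj₂ x → Kind (inj₁ i)

      kind : ∀ z → Kind z
      kind (inj₁ i) with lookup w i in e
      ... | inj₁ c = old c e
      ... | inj₂ x = new i x e
      kind (inj₂ i) = old (lookup b i) refl

      kind-unique : ∀ {z} (κ κ' : Kind z) → κ ≡ κ'
      kind-unique (old c e)   (old c' e')   = cong (λ ce → old (proj₁ ce) (proj₂ ce)) (inj₁-fiber-unique e e')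
      kind-unique (old c e)   (new i x e')  = ⊥-elim (inj₁≢inj₂ (trans (sym e) e'))
      kind-unique (new i x e) (old c e')    = ⊥-elim (inj₁≢inj₂ (trans (sym e') e))
      kind-unique (new i x e) (new .i x' e') = cong (λ xe → new i (proj₁ xe) (proj₂ xe)) (inj₂-fiber-unique e e')

      oldVar : (z : Term m n) (c : Car B) → elem z ≡ inj₁ c → Fin Γ
      oldVar (inj₁ i) c e = argVar (inj₁ i) (oldPos (lookup w i) e)
      oldVar (inj₂ i) c e = freeVar i

      lookup-oldVar : ∀ z c e → lookup valuation (oldVar z c e) ≡ c
      lookup-oldVar (inj₁ i) c e = trans (lookup-argVar (inj₁ i) _) (lookup-oldPos (lookup w i) e)
      lookup-oldVar (inj₂ i) c e = trans (lookup-freeVar i) (inj₁-injective e)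

      data Position (τ : Ax T) (a : Vec (Car B) (nx T τ)) (p : ⟦ conj (pre T τ) ⟧ B a) :
                    Term m n → Fin (ny T τ + nx T τ) → Set where
        witnessPos  : (i : Fin m) (j : Fin (ny T τ)) → lookup w i ≡ inj₂ (τ , a , p , j) →
                      Position τ a p (inj₁ i) (j ↑ˡ nx T τ)
        argumentPos : ∀ {z} (q : Fin (nx T τ)) → elem z ≡ inj₁ (lookup a q) → Position τ a p z (xvar (ny T τ) q)

      position : ∀ τ a p z t → elem z ≡ lookup (val B τ a p) t → Position τ a p z t
      position τ a p z t e with splitView (ny T τ) t
      position τ a p (inj₁ i) _ e | left j  = witnessPos i j (trans e (lookup-val-witness B τ a p j))
      position τ a p (inj₂ i) _ e | left j  = ⊥-elim (inj₁≢inj₂ (trans e (lookup-val-witness B τ a p j)))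
      position τ a p z        _ e | right q = argumentPos q (trans e (lookup-val-argument B τ a p q))

      positions : ∀ {R} (ks : Vec (Term m n) (ar R)) τ a p (ts : Vec (Fin (ny T τ + nx T τ)) (ar R)) →
                  map elem ks ≡ map (lookup (val B τ a p)) ts → ∀ i → Position τ a p (lookup ks i) (lookup ts i)
      positions ks τ a p ts e i =
        position τ a p (lookup ks i) (lookup ts i)
          (trans (sym (lookup-map i elem ks)) (trans (cong (λ xs → lookup xs i) e) (lookup-map i _ ts)))

      factPositions : ∀ {R} (ks : Vec (Term m n) (ar R)) {τ a p} (any : Any (λ α → Contrib (val B τ a p) α R (map elem ks)) (post T τ)) →
                      ∀ i → Position τ a p (lookup ks i) (lookup (proj₁ (contribution any)) i)
      factPositions ks {τ} {a} {p} any = positions ks τ a p (proj₁ (contribution any)) (proj₂ (proj₂ (contribution any)))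

      -- Triggers shown equal by the witnesses are identified, so one firing serves all their nodes.
      open UnionFind (≡-dec Fin._≟_ Fin._≟_) triggerN

      witnessLinks : ∀ k {τ a p} → triggerN (inj₂ k) ≡ just (τ , a , p) → ∀ {z t} → Position τ a p z t → List Link
      witnessLinks k eq-t (witnessPos i j e) = [ (inj₁ i , inj₂ k) , trans (cong triggerᵉ e) (sym eq-t) ]
      witnessLinks k eq-t (argumentPos _ _)  = []

      factLinks : ∀ k {R} (ks : Vec (Term m n) (ar R)) (x : T1Rel B R (map elem ks)) → triggerN (inj₂ k) ≡ triggerʳ x → List Link
      factLinks k ks (old _ _ _)     eq-t = []
      factLinks k ks (new τ a p any) eq-t = List.concat (List.tabulate λ i → witnessLinks k eq-t (factPositions ks any i))

      equationLinks : (z₁ z₂ : Term m n) → elem z₁ ≡ elem z₂ → List Link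
      equationLinks (inj₁ i₁) (inj₁ i₂) e = [ (inj₁ i₁ , inj₁ i₂) , cong triggerᵉ e ]
      equationLinks _         _         _ = []

      links : List Link
      links = List.concat (List.tabulate λ k → factLinks k (termsAt k) (⊨occ k) refl)
              List.++ List.concat (List.tabulate λ k → equationLinks (proj₁ (equation P k)) (proj₂ (equation P k)) (⊨eq k))

      π : Partition
      π = partition links

      repN : Node → Node
      repN = rep π

      factLinks-identified : ∀ k → All (Identifies π) (factLinks k (termsAt k) (⊨occ k) refl)
      factLinks-identified = tabulate⁻ (concat⁻ (++⁻ˡ _ (partition-identifies links)))

      equationLinks-identified : ∀ k → All (Identifies π) (equationLinks (eqLhs k) (eqRhs k) (⊨eq k))
      equationLinks-identified = tabulate⁻ (concat⁻ (++⁻ʳ _ (partition-identifies links)))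

      rep-axiom : ∀ nd {τ} → axiomN nd ≡ just τ → axiomN (repN nd) ≡ just τ
      rep-axiom nd e = trans (cong axiomOf (rep-resp π nd)) e

      premise : ∀ nd (y : Maybe (Ax T)) → axiomN nd ≡ y → Fm Γ
      premise nd nothing  _ = ⊤
      premise nd (just τ) e = ren (premiseArgs nd e) (conj (pre T τ))

      premise-irrelevant : ∀ nd {y y'} (e : axiomN nd ≡ y) (e' : axiomN nd ≡ y') → premise nd y e ≡ premise nd y' e'
      premise-irrelevant nd refl refl = refl

      oldTuple : ∀ {a} (ks : Vec (Term m n) a) (d : Vec (Car B) a) → map elem ks ≡ map inj₁ d → Vec (Fin Γ) a
      oldTuple []       []      e = []
      oldTuple (z ∷ ks) (c ∷ d) e = oldVar z c (∷-injectiveˡ e) ∷ oldTuple ks d (∷-injectiveʳ e)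

      oldFact : ∀ {R} (ks : Vec (Term m n) (ar R)) → T1Rel B R (map elem ks) → Fm Γ
      oldFact {R} ks (old d _ e)   = rel R (oldTuple ks d e)
      oldFact     ks (new _ _ _ _) = ⊤

      -- A new fact is derived from the firing at its representative, hence compared with its arguments.
      repArgs : ∀ k {τ a p} → triggerN (inj₂ k) ≡ just (τ , a , p) → Fin (nx T τ) → Fin Γ
      repArgs k eq-t = premiseArgs (repN (inj₂ k)) (rep-axiom (inj₂ k) (cong axiomOf eq-t))

      argumentEq : ∀ {τ a p z t} → Position τ a p z t → (Fin (nx T τ) → Fin Γ) → Fm Γ
      argumentEq (witnessPos _ _ _) f = ⊤
      argumentEq {a = a} {z = z} (argumentPos q e) f = eq (oldVar z (lookup a q) e) (f q)

      argumentEqs : ∀ k {R} (ks : Vec (Term m n) (ar R)) (x : T1Rel B R (map elem ks)) → triggerN (inj₂ k) ≡ triggerʳ x → Fm Γ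
      argumentEqs k ks (old _ _ _)     eq-t = ⊤
      argumentEqs k ks (new τ a p any) eq-t = ⋀ λ i → argumentEq (factPositions ks any i) (repArgs k eq-t)

      equationFormula : (z₁ z₂ : Term m n) → Kind z₁ → Kind z₂ → Fm Γ
      equationFormula z₁ z₂ (old c₁ e₁) (old c₂ e₂) = eq (oldVar z₁ c₁ e₁) (oldVar z₂ c₂ e₂)
      equationFormula _  _  _           _           = ⊤

      premisesV premisesR oldFacts argumentEqualities equations χ : Fm Γ
      premisesV = ⋀ λ i → premise (inj₁ i) (axiomN (inj₁ i)) refl
      premisesR = ⋀ λ k → premise (inj₂ k) (axiomN (inj₂ k)) refl
      oldFacts = ⋀ λ k → oldFact (termsAt k) (⊨occ k)
      argumentEqualities = ⋀ λ k → argumentEqs k (termsAt k) (⊨occ k) refl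
      equations = ⋀ λ k → equationFormula (eqLhs k) (eqRhs k) (kind (eqLhs k)) (kind (eqRhs k))
      χ = premisesV ∧ (premisesR ∧ (oldFacts ∧ (argumentEqualities ∧ equations)))

      Valid : Fm Γ → Set
      Valid φ = ⟦ φ ⟧ B valuation

      trigger-with-axiom : ∀ {x : Maybe (Trigger B)} {τ} → axiomOf x ≡ just τ → Σ (Trigger B) λ t → (x ≡ just t) × (proj₁ t ≡ τ)
      trigger-with-axiom {just t} refl = t , refl , refl

      premise-valid : ∀ nd y (e : axiomN nd ≡ y) → Valid (premise nd y e)
      premise-valid nd nothing  e = unit
      premise-valid nd (just τ) e with trigger-with-axiom e
      ... | (τ , a , p) , et , refl = ⟦⟧-ren (premiseArgs nd e) (conj (pre T τ)) (λ q → sym (lookup-premiseArgs nd et e q)) p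

      oldTuple-valid : ∀ {a} (ks : Vec (Term m n) a) d e → map (lookup valuation) (oldTuple ks d e) ≡ d
      oldTuple-valid []       []      e = refl
      oldTuple-valid (z ∷ ks) (c ∷ d) e = cong₂ _∷_ (lookup-oldVar z c _) (oldTuple-valid ks d _)

      oldFact-valid : ∀ {R} (ks : Vec (Term m n) (ar R)) x → Valid (oldFact ks x)
      oldFact-valid {R} ks (old d r e)   = subst (relS B R) (sym (oldTuple-valid ks d e)) r
      oldFact-valid     ks (new _ _ _ _) = unit

      argumentEq-valid : ∀ {τ a p z t} (pos : Position τ a p z t) f → (∀ q → lookup valuation (f q) ≡ lookup a q) →
                         Valid (argumentEq pos f)
      argumentEq-valid (witnessPos _ _ _) f h = unit
      argumentEq-valid {a = a} {z = z} (argumentPos q e) f h = trans (lookup-oldVar z (lookup a q) e) (sym (h q))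

      argumentEqs-valid : ∀ k {R} (ks : Vec (Term m n) (ar R)) x eq-t → Valid (argumentEqs k ks x eq-t)
      argumentEqs-valid k ks (old _ _ _)     eq-t = unit
      argumentEqs-valid k ks (new τ a p any) eq-t =
        ⟦⋀⟧-intro _ valuation λ i → argumentEq-valid (factPositions ks any i) (repArgs k eq-t)
          (lookup-premiseArgs (repN (inj₂ k)) (trans (rep-resp π (inj₂ k)) eq-t) _)

      equationFormula-valid : ∀ z₁ z₂ κ₁ κ₂ → elem z₁ ≡ elem z₂ → Valid (equationFormula z₁ z₂ κ₁ κ₂)
      equationFormula-valid z₁ z₂ (old c₁ e₁) (old c₂ e₂) e =
        trans (lookup-oldVar z₁ c₁ e₁) (trans (inj₁-injective (trans (sym e₁) (trans e e₂))) (sym (lookup-oldVar z₂ c₂ e₂)))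
      equationFormula-valid z₁ z₂ (old _ _)   (new _ _ _) e = unit
      equationFormula-valid z₁ z₂ (new _ _ _) _           e = unit

      χ-valid : Valid χ
      χ-valid = ⟦⋀⟧-intro _ valuation (λ i → premise-valid (inj₁ i) _ refl)
              , (⟦⋀⟧-intro _ valuation (λ k → premise-valid (inj₂ k) _ refl)
              , (⟦⋀⟧-intro _ valuation (λ k → oldFact-valid (termsAt k) (⊨occ k))
              , (⟦⋀⟧-intro _ valuation (λ k → argumentEqs-valid k (termsAt k) (⊨occ k) refl)
              , ⟦⋀⟧-intro _ valuation (λ k → equationFormula-valid (eqLhs k) (eqRhs k) (kind (eqLhs k)) (kind (eqRhs k)) (⊨eq k)))))

      ψ : Fm n
      ψ = exsBlocks #argsR (exsBlocks #argsV χ)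

      ψ-valid : ⟦ ψ ⟧ B b
      ψ-valid = ⟦exsBlocks⟧-intro #argsR _ _ b (⟦exsBlocks⟧-intro #argsV χ _ _ χ-valid)

      module Derive {G} (E : Fin Γ → Fin G) (yN : ∀ nd → Fin (arityʸ (axiomN nd)) → Fin G) (χ' : Fm G) (⊢χ : χ' ⊢ ren E χ)
          (⊢post : ∀ nd {τ} (e : axiomN nd ≡ just τ) →
                   χ' ⊢ ren ((yN nd ∘ castʸ e) VF.++ (E ∘ premiseArgs nd e)) (conj (post T τ))) where

        from-χ : ∀ {φ} → χ ⊢ φ → χ' ⊢ ren E φ
        from-χ d = cut ⊢χ (rename E d)

        ≡⇒⊢eq : ∀ {x y} → x ≡ y → χ' ⊢ eq x y
        ≡⇒⊢eq {x} refl = eq-refl′ x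

        witnessIndex : (x : New B) → Fin (ny T (proj₁ x))
        witnessIndex (_ , _ , _ , j) = j

        witnessVar : ∀ i (x : New B) → lookup w i ≡ inj₂ x → Fin G
        witnessVar i x e = yN (repN (inj₁ i)) (castʸ (rep-axiom (inj₁ i) (cong (axiomOf ∘ triggerᵉ) e)) (witnessIndex x))

        witness-cong : ∀ nd₁ nd₂ (x₁ x₂ : New B) (e₁ : axiomN nd₁ ≡ just (proj₁ x₁)) (e₂ : axiomN nd₂ ≡ just (proj₁ x₂)) →
                       nd₁ ≡ nd₂ → x₁ ≡ x₂ → yN nd₁ (castʸ e₁ (witnessIndex x₁)) ≡ yN nd₂ (castʸ e₂ (witnessIndex x₂))
        witness-cong nd _ x _ e₁ e₂ refl refl = cong (λ e → yN nd (castʸ e (witnessIndex x))) (uip e₁ e₂)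

        varOf : ∀ z → Kind z → Fin G
        varOf z (old c e)   = E (oldVar z c e)
        varOf _ (new i x e) = witnessVar i x e

        h : Term m n → Fin G
        h z = varOf z (kind z)

        h-kind : ∀ z κ → h z ≡ varOf z κ
        h-kind z κ = cong (varOf z) (kind-unique (kind z) κ)

        ⊢equation : ∀ z₁ z₂ (κ₁ : Kind z₁) (κ₂ : Kind z₂) (e : elem z₁ ≡ elem z₂) → All (Identifies π) (equationLinks z₁ z₂ e) →
                    χ' ⊢ ren E (equationFormula z₁ z₂ κ₁ κ₂) → χ' ⊢ eq (varOf z₁ κ₁) (varOf z₂ κ₂)
        ⊢equation z₁ z₂ (old c₁ e₁)    (old c₂ e₂)    e _ d = d
        ⊢equation z₁ _  (old c₁ e₁)    (new i x e₂)   e _ d = ⊥-elim (inj₁≢inj₂ (trans (sym e₁) (trans e e₂)))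
        ⊢equation _  z₂ (new i x e₁)   (old c₂ e₂)    e _ d = ⊥-elim (inj₁≢inj₂ (trans (sym e₂) (trans (sym e) e₁)))
        ⊢equation _  _  (new i₁ x₁ e₁) (new i₂ x₂ e₂) e (same ∷ []) d =
          ≡⇒⊢eq (witness-cong _ _ x₁ x₂ _ _ same (inj₂-injective (trans (sym e₁) (trans e e₂))))

        oldTuple-h : ∀ {a} (ks : Vec (Term m n) a) d e → map h ks ≡ map E (oldTuple ks d e)
        oldTuple-h []       []      e = refl
        oldTuple-h (z ∷ ks) (c ∷ d) e = cong₂ _∷_ (h-kind z (old c _)) (oldTuple-h ks d _)

        module NewFact (k : Fin r) {τ a p} (eq-t : triggerN (inj₂ k) ≡ just (τ , a , p)) where
          rk : Node
          rk = repN (inj₂ k)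

          eq-rk : axiomN rk ≡ just τ
          eq-rk = rep-axiom (inj₂ k) (cong axiomOf eq-t)

          Φ : Fin (ny T τ + nx T τ) → Fin G
          Φ = (yN rk ∘ castʸ eq-rk) VF.++ (E ∘ premiseArgs rk eq-rk)

          ⊢position : ∀ {z t} (pos : Position τ a p z t) → χ' ⊢ ren E (argumentEq pos (repArgs k eq-t)) →
                      All (Identifies π) (witnessLinks k eq-t pos) → χ' ⊢ eq (Φ t) (h z)
          ⊢position (witnessPos i j e) _ (same ∷ []) =
            ≡⇒⊢eq (trans (VFP.lookup-++ˡ (yN rk ∘ castʸ eq-rk) _ j)
                    (trans (witness-cong rk (repN (inj₁ i)) (τ , a , p , j) (τ , a , p , j) _ _ (sym same) refl)
                           (sym (h-kind (inj₁ i) (new i _ e)))))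
          ⊢position {z} (argumentPos q e) d _ =
            subst₂ (λ u v → χ' ⊢ eq u v)
              (sym (++ᶠ-xvar (yN rk ∘ castʸ eq-rk) (E ∘ premiseArgs rk eq-rk) q)) (sym (h-kind z (old _ e)))
              (eq-sym′ d)

          ⊢fact : ∀ {R} (ks : Vec (Term m n) (ar R)) (any : Any (λ α → Contrib (val B τ a p) α R (map elem ks)) (post T τ)) →
                  χ' ⊢ ren E (⋀ λ i → argumentEq (factPositions ks any i) (repArgs k eq-t)) →
                  All (Identifies π) (List.concat (List.tabulate λ i → witnessLinks k eq-t (factPositions ks any i))) →
                  χ' ⊢ rel R (map h ks)
          ⊢fact {R} ks any ⊢args same = rel-cong ⊢Φts λ i →
            subst₂ (λ u v → χ' ⊢ eq u v) (sym (lookup-map i Φ ts)) (sym (lookup-map i h ks))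
              (⊢position (factPositions ks any i) (cut ⊢args (rename E (⋀-elim _ i))) (tabulate⁻ (concat⁻ same) i))
            where
              ts : Vec (Fin (ny T τ + nx T τ)) (ar R)
              ts = proj₁ (contribution any)
              ⊢Φts : χ' ⊢ rel R (map Φ ts)
              ⊢Φts = cut (⊢post rk eq-rk) (rename Φ (conj-elim (proj₁ (proj₂ (contribution any)))))

        ⊢fact : ∀ k {R} (ks : Vec (Term m n) (ar R)) (x : T1Rel B R (map elem ks)) (eq-t : triggerN (inj₂ k) ≡ triggerʳ x) →
                χ' ⊢ ren E (oldFact ks x) → χ' ⊢ ren E (argumentEqs k ks x eq-t) → All (Identifies π) (factLinks k ks x eq-t) →
                χ' ⊢ rel R (map h ks)
        ⊢fact k {R} ks (old d _ e)     eq-t ⊢old _     _    = subst (λ xs → χ' ⊢ rel R xs) (sym (oldTuple-h ks d e)) ⊢old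
        ⊢fact k     ks (new τ a p any) eq-t _    ⊢args same = NewFact.⊢fact k eq-t ks any ⊢args same

        derives : Derives χ' h P
        derives =
          (λ k → ⊢fact k (termsAt k) (⊨occ k) refl (from-χ (cut oldFacts-elim (⋀-elim _ k)))
                   (from-χ (cut argumentEqualities-elim (⋀-elim _ k))) (factLinks-identified k)) ,
          (λ k → ⊢equation (eqLhs k) (eqRhs k) (kind (eqLhs k)) (kind (eqRhs k)) (⊨eq k) (equationLinks-identified k)
                   (from-χ (cut equations-elim (⋀-elim _ k))))
          where
            oldFacts-elim : χ ⊢ oldFacts
            oldFacts-elim = cut ∧-elimʳ (cut ∧-elimʳ ∧-elimˡ)
            argumentEqualities-elim : χ ⊢ argumentEqualities
            argumentEqualities-elim = cut ∧-elimʳ (cut ∧-elimʳ (cut ∧-elimʳ ∧-elimˡ))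
            equations-elim : χ ⊢ equations
            equations-elim = cut ∧-elimʳ (cut ∧-elimʳ (cut ∧-elimʳ ∧-elimʳ))

      χ⊢ : ∀ {φ} → Entails P φ → χ ⊢ ren freeVar φ
      χ⊢ {φ} entails = chase-instances m (axiomN ∘ inj₁) (λ i → premiseArgs (inj₁ i)) ⊢premiseV chasedV
        where
          ⊢premiseV : ∀ i {τ} (e : axiomN (inj₁ i) ≡ just τ) → χ ⊢ ren (premiseArgs (inj₁ i) e) (conj (pre T τ))
          ⊢premiseV i e = subst (χ ⊢_) (premise-irrelevant (inj₁ i) refl e) (cut ∧-elimˡ (⋀-elim _ i))

          ⊢premiseR : ∀ k {τ} (e : axiomN (inj₂ k) ≡ just τ) → χ ⊢ ren (premiseArgs (inj₂ k) e) (conj (pre T τ))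
          ⊢premiseR k e = subst (χ ⊢_) (premise-irrelevant (inj₂ k) refl e) (cut (cut ∧-elimʳ ∧-elimˡ) (⋀-elim _ k))

          chasedV : Chased (axiomN ∘ inj₁) (λ i → premiseArgs (inj₁ i)) χ (ren freeVar φ)
          chasedV E₁ y₁ χ₁ ⊢χ₁ ⊢post₁ =
            chase-instances r (axiomN ∘ inj₂) (λ k e → E₁ ∘ premiseArgs (inj₂ k) e)
              (λ k e → subst (χ₁ ⊢_) (ren-∘ E₁ (premiseArgs (inj₂ k) e) _) (cut ⊢χ₁ (rename E₁ (⊢premiseR k e))))
              chasedR
            where
              chasedR : Chased (axiomN ∘ inj₂) (λ k e → E₁ ∘ premiseArgs (inj₂ k) e) χ₁ (ren E₁ (ren freeVar φ))
              chasedR E₂ y₂ χ₂ ⊢χ₂ ⊢post₂ =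
                subst (χ₂ ⊢_) (trans (sym (ren-∘ (E₂ ∘ E₁) freeVar φ)) (sym (ren-∘ E₂ E₁ (ren freeVar φ))))
                  (entails χ₂ (Derive.h (E₂ ∘ E₁) yN χ₂ ⊢χ ⊢post) (Derive.derives (E₂ ∘ E₁) yN χ₂ ⊢χ ⊢post))
                where
                  ⊢χ : χ₂ ⊢ ren (E₂ ∘ E₁) χ
                  ⊢χ = subst (χ₂ ⊢_) (ren-∘ E₂ E₁ χ) (cut ⊢χ₂ (rename E₂ ⊢χ₁))

                  yN : ∀ nd → Fin (arityʸ (axiomN nd)) → Fin _
                  yN (inj₁ i) q = E₂ (y₁ i q)
                  yN (inj₂ k) q = y₂ k q

                  ⊢post : ∀ nd {τ} (e : axiomN nd ≡ just τ) →
                          χ₂ ⊢ ren ((yN nd ∘ castʸ e) VF.++ (E₂ ∘ E₁ ∘ premiseArgs nd e)) (conj (post T τ))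
                  ⊢post (inj₁ i) {τ} e =
                    subst (χ₂ ⊢_) (trans (ren-∘ E₂ ((y₁ i ∘ castʸ e) VF.++ (E₁ ∘ premiseArgs (inj₁ i) e)) (conj (post T τ)))
                                         (ren-cong (∘-++ᶠ E₂ (y₁ i ∘ castʸ e) (E₁ ∘ premiseArgs (inj₁ i) e)) (conj (post T τ))))
                      (cut ⊢χ₂ (rename E₂ (⊢post₁ i e)))
                  ⊢post (inj₂ k) e = ⊢post₂ k e

      ψ⊢ : ∀ {φ} → Entails P φ → ψ ⊢ φ
      ψ⊢ {φ} entails = exsBlocks-elim #argsR (exsBlocks-elim #argsV (subst (χ ⊢_) (sym (ren-∘ _ _ φ)) (χ⊢ entails)))

    T1-conservative : (B : Str) → Conservative T B (T1 B) inj₁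
    T1-conservative B φ b s = ψ , ψ-valid , ψ⊢ F.entails
      where
        module F = Flattened (flatten φ (map inj₁ b) s)
        elem-value : ∀ t → value F.witness (map inj₁ b) t ≡ elemAt F.witness b t
        elem-value (inj₁ i) = refl
        elem-value (inj₂ i) = lookup-map i inj₁ b
        open Construction B b F.flat F.witness
          (λ k → subst (T1Rel B _) (map-cong elem-value _) (proj₁ F.holds k))
          (λ k → trans (sym (elem-value (proj₁ (equation F.flat k)))) (trans (proj₂ F.holds k) (elem-value (proj₂ (equation F.flat k)))))

  module ChainColimit (T : Theory) where
    open Chasing T
    open OneStep T
    open OneStepConservative T using (T1-conservative)

    conservative-id : ∀ {A : Str} → Conservative T A A id
    conservative-id {A} φ a s = φ , subst (⟦ φ ⟧ A) (map-id a) s , idty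

    conservative-∘ : ∀ {A B C : Str} {f : Car A → Car B} {g : Car B → Car C} →
                     Conservative T B C g → Conservative T A B f → Conservative T A C (g ∘ f)
    conservative-∘ {C = C} {f} {g} cons-g cons-f φ a s =
      let (ψ₁ , s₁ , ψ₁⊢φ) = cons-g φ (map f a) (subst (⟦ φ ⟧ C) (map-∘ g f a) s)
          (ψ₂ , s₂ , ψ₂⊢ψ₁) = cons-f ψ₁ a s₁
      in ψ₂ , s₂ , cut ψ₂⊢ψ₁ ψ₁⊢φ

    ι : (X : Str) → Hom X (T1 X)
    ι X = hom inj₁ (λ R c r → old c r refl)

    T1-model-of-trigger : ∀ (X : Str) τ (a : Vec (Car X) (nx T τ)) (s : ⟦ conj (pre T τ) ⟧ X a) → All IsRelAtom (post T τ) →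
                          ⟦ exs (ny T τ) (conj (post T τ)) ⟧ (T1 X) (map inj₁ a)
    T1-model-of-trigger X τ a s rel-atoms =
      ⟦exs⟧-intro (ny T τ) (conj (post T τ)) _ (map inj₁ a)
        (⟦conj⟧-intro (post T τ) (val X τ a s) (All.tabulate λ α∈ → atom-holds (All.lookup rel-atoms α∈) α∈))
      where
        atom-holds : ∀ {α} → IsRelAtom α → α ∈ post T τ → ⟦ atom α ⟧ (T1 X) (val X τ a s)
        atom-holds (isRel R ts) α∈ = new τ a s (Any.map (λ { refl → mk refl }) α∈)

    module Colimit (A : Str) where

      up : ∀ {k K} → k ≤′ K → Hom (stage k A) (stage K A)
      up ≤′-refl      = idHom _
      up (≤′-step p) = ι _ ∘H up p

      incl-up : ∀ {k K} (p : k ≤′ K) x → incl K (fun (up p) x) ≡ incl k x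
      incl-up ≤′-refl      x = refl
      incl-up (≤′-step p) x = incl-up p x

      level : ∀ k (x : Car (stage k A)) → proj₁ (incl k x) ≤ k
      level zero    x        = z≤n
      level (suc k) (inj₁ x) = ≤-trans (level k x) (n≤1+n k)
      level (suc k) (inj₂ t) = ≤-refl

      incl-injective : ∀ k {x y : Car (stage k A)} → incl k x ≡ incl k y → x ≡ y
      incl-injective zero    refl = refl
      incl-injective (suc k) {inj₁ x} {inj₁ y} e = cong inj₁ (incl-injective k e)
      incl-injective (suc k) {inj₁ x} {inj₂ t} e = ⊥-elim (1+n≰n (subst (_≤ k) (cong proj₁ e) (level k x)))
      incl-injective (suc k) {inj₂ t} {inj₁ y} e = ⊥-elim (1+n≰n (subst (_≤ k) (cong proj₁ (sym e)) (level k y)))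
      incl-injective (suc k) {inj₂ t} {inj₂ .t} refl = refl

      map-incl-injective : ∀ k {l} {u v : Vec (Car (stage k A)) l} → map (incl k) u ≡ map (incl k) v → u ≡ v
      map-incl-injective k {u = u} {v} e = lookup-extensional λ i →
        incl-injective k (trans (sym (lookup-map i (incl k) u)) (trans (cong (λ xs → lookup xs i) e) (lookup-map i (incl k) v)))

      map-incl-up : ∀ {k K l} (p : k ≤′ K) (v : Vec (Car (stage k A)) l) → map (incl K) (map (fun (up p)) v) ≡ map (incl k) v
      map-incl-up p v = trans (sym (map-∘ _ _ v)) (map-cong (incl-up p) v)

      up-∘ : ∀ {k K K'} (p : k ≤′ K) (q : K ≤′ K') {l} (v : Vec (Car (stage k A)) l) →
             map (fun (up q)) (map (fun (up p)) v) ≡ map (fun (up (≤′-trans p q))) v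
      up-∘ {K' = K'} p q v = map-incl-injective K'
        (trans (map-incl-up q _) (trans (map-incl-up p v) (sym (map-incl-up (≤′-trans p q) v))))

      up-irrelevant : ∀ {k K} (p q : k ≤′ K) {l} (v : Vec (Car (stage k A)) l) → map (fun (up p)) v ≡ map (fun (up q)) v
      up-irrelevant {K = K} p q v = map-incl-injective K (trans (map-incl-up p v) (sym (map-incl-up q v)))

      raise : ∀ {k K K' l} (φ : Fm l) (p : k ≤′ K) (q : K ≤′ K') {v : Vec (Car (stage k A)) l} →
              ⟦ φ ⟧ (stage K A) (map (fun (up p)) v) → ⟦ φ ⟧ (stage K' A) (map (fun (up (≤′-trans p q))) v)
      raise {K' = K'} φ p q {v} s = subst (⟦ φ ⟧ (stage K' A)) (up-∘ p q v) (presF (up q) φ (map (fun (up p)) v) s)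

      ≤′-⊔ˡ : ∀ a b → a ≤′ a ⊔ b
      ≤′-⊔ˡ a b = ≤⇒≤′ (m≤m⊔n a b)

      ≤′-⊔ʳ : ∀ a b → b ≤′ a ⊔ b
      ≤′-⊔ʳ a b = ≤⇒≤′ (m≤n⊔m a b)

      embed-at : (x : ChCar A) → ∀ {K} → proj₁ x ≤′ K → Car (stage K A)
      embed-at (j , t) p = fun (up p) (embed j t)

      incl-embed : ∀ j (t : NewAt A j) → incl j (embed j t) ≡ (j , t)
      incl-embed zero    t = refl
      incl-embed (suc j) t = refl

      incl-embed-at : ∀ x {K} (p : proj₁ x ≤′ K) → incl K (embed-at x p) ≡ x
      incl-embed-at (j , t) p = trans (incl-up p (embed j t)) (incl-embed j t)

      map-lookup : ∀ {X Y : Set} {l k} (f : X → Y) (u : Vec X l) (ts : Vec (Fin l) k) →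
                   map f (map (lookup u) ts) ≡ map (lookup (map f u)) ts
      map-lookup f u ts = trans (sym (map-∘ f (lookup u) ts)) (map-cong (λ i → sym (lookup-map i f u)) ts)

      Reflected : ∀ {n} → Fm n → ∀ K → Vec (Car (stage K A)) n → Set
      Reflected φ K v = Σ ℕ λ K' → Σ (K ≤′ K') λ p → ⟦ φ ⟧ (stage K' A) (map (fun (up p)) v)

      reflect : ∀ {n} (φ : Fm n) K (v : Vec (Car (stage K A)) n) → ⟦ φ ⟧ (Ch A) (map (incl K) v) → Reflected φ K v
      reflect (rel R ts) K v (k , d , r , e) =
        K ⊔ k , ≤′-⊔ˡ K k ,
        subst (relS (stage (K ⊔ k) A) R) (map-incl-injective (K ⊔ k) same-image) (pres (up (≤′-⊔ʳ K k)) R d r)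
        where
          same-image : map (incl (K ⊔ k)) (map (fun (up (≤′-⊔ʳ K k))) d) ≡
                       map (incl (K ⊔ k)) (map (lookup (map (fun (up (≤′-⊔ˡ K k))) v)) ts)
          same-image = trans (map-incl-up (≤′-⊔ʳ K k) d) (trans e
                         (sym (trans (map-lookup (incl (K ⊔ k)) (map (fun (up (≤′-⊔ˡ K k))) v) ts)
                                     (cong (λ u → map (lookup u) ts) (map-incl-up (≤′-⊔ˡ K k) v)))))
      reflect (eq i j) K v s =
        K , ≤′-refl , subst₂ _≡_ (sym (lookup-map i id v)) (sym (lookup-map j id v))
          (incl-injective K (trans (sym (lookup-map i (incl K) v)) (trans s (lookup-map j (incl K) v))))
      reflect ⊤ K v s = K , ≤′-refl , unit
      reflect (φ₁ ∧ φ₂) K v (s₁ , s₂) =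
        let (K₁ , p₁ , t₁) = reflect φ₁ K v s₁
            (K₂ , p₂ , t₂) = reflect φ₂ K v s₂
        in K₁ ⊔ K₂ , ≤′-trans p₁ (≤′-⊔ˡ K₁ K₂) ,
           raise φ₁ p₁ (≤′-⊔ˡ K₁ K₂) t₁ ,
           subst (⟦ φ₂ ⟧ (stage (K₁ ⊔ K₂) A)) (up-irrelevant (≤′-trans p₂ (≤′-⊔ʳ K₁ K₂)) (≤′-trans p₁ (≤′-⊔ˡ K₁ K₂)) v)
             (raise φ₂ p₂ (≤′-⊔ʳ K₁ K₂) t₂)
      reflect (ex φ) K v (x , s) =
        let (K' , p' , t) = reflect φ K₀ (y ∷ map (fun (up p₀)) v) (⟦⟧-resp φ lookups s)
        in K' , ≤′-trans p₀ p' , fun (up p') y , subst (λ u → ⟦ φ ⟧ (stage K' A) (fun (up p') y ∷ u)) (up-∘ p₀ p' v) t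
        where
          K₀ : ℕ
          K₀ = K ⊔ proj₁ x
          p₀ : K ≤′ K₀
          p₀ = ≤′-⊔ˡ K (proj₁ x)
          y : Car (stage K₀ A)
          y = embed-at x (≤′-⊔ʳ K (proj₁ x))
          lookups : ∀ i → lookup (x ∷ map (incl K) v) i ≡ lookup (map (incl K₀) (y ∷ map (fun (up p₀)) v)) i
          lookups zero    = sym (incl-embed-at x (≤′-⊔ʳ K (proj₁ x)))
          lookups (suc i) = cong (λ u → lookup u i) (sym (map-incl-up p₀ v))

      up-conservative : ∀ {k K} (p : k ≤′ K) → Conservative T (stage k A) (stage K A) (fun (up p))
      up-conservative ≤′-refl      = conservative-id
      up-conservative (≤′-step p) = conservative-∘ (T1-conservative _) (up-conservative p)

      η-conservative : Conservative T A (Ch A) (η A)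
      η-conservative φ a s = let (K , p , s′) = reflect φ 0 a s in up-conservative p φ a s′

      maxLevel : ∀ {l} → Vec (ChCar A) l → ℕ
      maxLevel []       = 0
      maxLevel (x ∷ xs) = proj₁ x ⊔ maxLevel xs

      ≤′-maxLevel : ∀ {l} (xs : Vec (ChCar A) l) i → proj₁ (lookup xs i) ≤′ maxLevel xs
      ≤′-maxLevel (x ∷ xs) zero    = ≤′-⊔ˡ (proj₁ x) (maxLevel xs)
      ≤′-maxLevel (x ∷ xs) (suc i) = ≤′-trans (≤′-maxLevel xs i) (≤′-⊔ʳ (proj₁ x) (maxLevel xs))

      common-stage : ∀ {l} (a : Vec (ChCar A) l) → Σ (Vec (Car (stage (maxLevel a) A)) l) λ a′ → map (incl (maxLevel a)) a′ ≡ a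
      common-stage a = tabulate f , lookup-extensional λ i →
        trans (lookup-map i (incl (maxLevel a)) (tabulate f))
              (trans (cong (incl (maxLevel a)) (lookup∘tabulate f i)) (incl-embed-at (lookup a i) (≤′-maxLevel a i)))
        where f = λ i → embed-at (lookup a i) (≤′-maxLevel a i)

      Ch-model : EqualityFree T → IsModel T (Ch A)
      Ch-model ef τ a ⊨pre =
        let (a′ , a′↦a) = common-stage a
            (K , p , ⊨pre′) = reflect (conj (pre T τ)) (maxLevel a) a′ (subst (⟦ conj (pre T τ) ⟧ (Ch A)) (sym a′↦a) ⊨pre)
        in subst (⟦ exs (ny T τ) (conj (post T τ)) ⟧ (Ch A)) (trans (incl-inj₁ p a′) a′↦a)
             (presF (inclHom (suc K)) (exs (ny T τ) (conj (post T τ))) _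
               (T1-model-of-trigger (stage K A) τ _ ⊨pre′ (proj₂ (ef τ))))
        where
          inclHom : ∀ k → Hom (stage k A) (Ch A)
          inclHom k = hom (incl k) (λ R d r → k , d , r , refl)
          incl-inj₁ : ∀ {k K l} (p : k ≤′ K) (u : Vec (Car (stage k A)) l) →
                      map (incl (suc K)) (map inj₁ (map (fun (up p)) u)) ≡ map (incl k) u
          incl-inj₁ p u = trans (sym (map-∘ (incl (suc _)) inj₁ _)) (map-incl-up p u)

  module Functoriality (T : Theory) where
    open OneStep T

    -- New elements carry proofs of premises, so homomorphisms are compared together with their
    -- preservation proofs; these live in different types, hence heterogeneous equality.
    infix 4 _≈ₕ_
    _≈ₕ_ : ∀ {X Y} (f g : Hom X Y) → Set
    _≈ₕ_ {X} {Y} f g = (∀ x → fun f x ≡ fun g x) × (∀ R c r → pres f R c r ≅ pres g R c r)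

    IsIdentity : ∀ {X} (f : Hom X X) → Set
    IsIdentity {X} f = (∀ x → fun f x ≡ x) × (∀ R c r → pres f R c r ≅ r)

    ≈ₕ-refl : ∀ {X Y} (f : Hom X Y) → f ≈ₕ f
    ≈ₕ-refl f = (λ x → refl) , (λ R c r → H.refl)

    ≈ₕ-trans : ∀ {X Y} {f g h : Hom X Y} → f ≈ₕ g → g ≈ₕ h → f ≈ₕ h
    ≈ₕ-trans (f≗g , f≅g) (g≗h , g≅h) = (λ x → trans (f≗g x) (g≗h x)) , (λ R c r → H.trans (f≅g R c r) (g≅h R c r))

    idHom-isIdentity : ∀ X → IsIdentity (idHom X)
    idHom-isIdentity X = (λ x → refl) , (λ R c r → H.≡-subst-removable (relS X R) _ r)

    ≡-≅ : ∀ {A : Set} {x y x' y' : A} (p : x ≡ y) (q : x' ≡ y') → x ≡ x' → y ≡ y' → p ≅ q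
    ≡-≅ refl refl refl refl = H.refl

    ,-≅ : ∀ {I : Set} {A : I → Set} {B : (i : I) → A i → Set} {i j} → i ≡ j →
          ∀ {a : A i} {a' : A j} {b : B i a} {b' : B j a'} → a ≅ a' → b ≅ b' →
          _≅_ {A = Σ (A i) (B i)} (a , b) {B = Σ (A j) (B j)} (a' , b')
    ,-≅ refl H.refl H.refl = H.refl

    presF-≈ₕ : ∀ {X Y} (f g : Hom X Y) → f ≈ₕ g → ∀ {n} (φ : Fm n) v p → presF f φ v p ≅ presF g φ v p
    presF-≈ₕ {Y = Y} f g (f≗g , f≅g) (rel R ts) v p =
      H.trans (H.≡-subst-removable (relS Y R) _ _) (H.trans (f≅g R _ p) (H.sym (H.≡-subst-removable (relS Y R) _ _)))
    presF-≈ₕ f g (f≗g , _) (eq i j) v p =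
      ≡-≅ _ _ (cong (λ xs → lookup xs i) (map-cong f≗g v)) (cong (λ xs → lookup xs j) (map-cong f≗g v))
    presF-≈ₕ f g f≈g ⊤ v p = H.refl
    presF-≈ₕ {Y = Y} f g f≈g (φ ∧ ψ) v (p , q) =
      ,-≅ {A = λ u → ⟦ φ ⟧ Y u} {B = λ u _ → ⟦ ψ ⟧ Y u} (map-cong (proj₁ f≈g) v)
        (presF-≈ₕ f g f≈g φ v p) (presF-≈ₕ f g f≈g ψ v q)
    presF-≈ₕ {Y = Y} f g f≈g (ex φ) v (x , p) =
      ,-≅ {A = λ _ → Car Y} {B = λ u y → ⟦ φ ⟧ Y (y ∷ u)} (map-cong (proj₁ f≈g) v)
        (H.≡-to-≅ (proj₁ f≈g x)) (presF-≈ₕ f g f≈g φ (x ∷ v) p)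

    presF-isIdentity : ∀ {X} (f : Hom X X) → IsIdentity f → ∀ {n} (φ : Fm n) v p → presF f φ v p ≅ p
    presF-isIdentity {X} f (f≗id , f≅id) (rel R ts) v p = H.trans (H.≡-subst-removable (relS X R) _ _) (f≅id R _ p)
    presF-isIdentity f (f≗id , _) (eq i j) v p =
      ≡-≅ _ _ (cong (λ xs → lookup xs i) (map-id-≗ f≗id v)) (cong (λ xs → lookup xs j) (map-id-≗ f≗id v))
    presF-isIdentity f f≈id ⊤ v p = H.refl
    presF-isIdentity {X} f f≈id (φ ∧ ψ) v (p , q) =
      ,-≅ {A = λ u → ⟦ φ ⟧ X u} {B = λ u _ → ⟦ ψ ⟧ X u} (map-id-≗ (proj₁ f≈id) v)
        (presF-isIdentity f f≈id φ v p) (presF-isIdentity f f≈id ψ v q)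
    presF-isIdentity {X} f f≈id (ex φ) v (x , p) =
      ,-≅ {A = λ _ → Car X} {B = λ u y → ⟦ φ ⟧ X (y ∷ u)} (map-id-≗ (proj₁ f≈id) v)
        (H.≡-to-≅ (proj₁ f≈id x)) (presF-isIdentity f f≈id φ (x ∷ v) p)

    pres-subst : ∀ {X Y} (g : Hom X Y) R {c₁ c₂} (e : c₁ ≡ c₂) r → pres g R c₂ (subst (relS X R) e r) ≅ pres g R c₁ r
    pres-subst g R refl r = H.refl

    presF-∘ : ∀ {X Y Z} (g : Hom Y Z) (f : Hom X Y) {n} (φ : Fm n) v p →
              presF (g ∘H f) φ v p ≅ presF g φ (map (fun f) v) (presF f φ v p)
    presF-∘ {X} {Y} {Z} g f (rel R ts) v p =
      H.trans (H.≡-subst-removable (relS Z R) (lookup-map-comm (fun (g ∘H f)) v) _)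
        (H.trans (H.≡-subst-removable (relS Z R) (sym (map-∘ (fun g) (fun f) (map (lookup v) ts))) _)
          (H.sym (H.trans (H.≡-subst-removable (relS Z R) (lookup-map-comm (fun g) (map (fun f) v)) _)
                          (pres-subst g R (lookup-map-comm (fun f) v) (pres f R (map (lookup v) ts) p)))))
      where
        lookup-map-comm : ∀ {U W : Set} (h : U → W) (u : Vec U _) → map h (map (lookup u) ts) ≡ map (lookup (map h u)) ts
        lookup-map-comm h u = trans (sym (map-∘ h (lookup u) ts)) (map-cong (λ i → sym (lookup-map i h u)) ts)
    presF-∘ g f (eq i j) v p =
      ≡-≅ _ _ (cong (λ xs → lookup xs i) (map-∘ (fun g) (fun f) v)) (cong (λ xs → lookup xs j) (map-∘ (fun g) (fun f) v))
    presF-∘ g f ⊤ v p = H.refl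
    presF-∘ {Z = Z} g f (φ ∧ ψ) v (p , q) =
      ,-≅ {A = λ u → ⟦ φ ⟧ Z u} {B = λ u _ → ⟦ ψ ⟧ Z u} (map-∘ (fun g) (fun f) v) (presF-∘ g f φ v p) (presF-∘ g f ψ v q)
    presF-∘ {Z = Z} g f (ex φ) v (x , p) =
      ,-≅ {A = λ _ → Car Z} {B = λ u y → ⟦ φ ⟧ Z (y ∷ u)} (map-∘ (fun g) (fun f) v) H.refl (presF-∘ g f φ (x ∷ v) p)

    Contrib-irrelevant : ∀ {X : Set} {k} {u : Vec X k} {α R c} (x y : Contrib u α R c) → x ≡ y
    Contrib-irrelevant (mk e) (mk e') = cong mk (uip e e')

    Any-map-≅-id : ∀ {X : Set} {k} {u u' : Vec X k} {R} {c c' : Vec X (ar R)} {L : List (Atom k)} → u ≡ u' → c ≡ c' →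
                   (F : ∀ {α} → Contrib u α R c → Contrib u' α R c') (x : Any (λ α → Contrib u α R c) L) → Any.map F x ≅ x
    Any-map-≅-id refl refl F x = H.≡-to-≅ (AnyP.map-id F (λ q → Contrib-irrelevant (F q) q) x)

    Any-map-≅ : ∀ {X : Set} {k} {Q : Atom k → Set} {L : List (Atom k)} (x : Any Q L) {u u' : Vec X k} {R} {c c' : Vec X (ar R)} →
                u ≡ u' → c ≡ c' → (F : ∀ {α} → Q α → Contrib u α R c) (F' : ∀ {α} → Q α → Contrib u' α R c') → Any.map F x ≅ Any.map F' x
    Any-map-≅ x refl refl F F' = H.≡-to-≅ (AnyP.map-cong F F' (λ q → Contrib-irrelevant (F q) (F' q)) x)

    old-≅ : ∀ {X : Str} {R} {c c' : Vec (T1Car X) (ar R)} {d d' : Vec (Car X) (ar R)} {r : relS X R d} {r' : relS X R d'}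
            {e : c ≡ map inj₁ d} {e' : c' ≡ map inj₁ d'} → c ≡ c' → d ≡ d' → r ≅ r' →
            _≅_ {A = T1Rel X R c} (old d r e) {B = T1Rel X R c'} (old d' r' e')
    old-≅ {d = d} {r = r} {e = e} {e'} refl refl H.refl = H.≡-to-≅ (cong (old d r) (uip e e'))

    new-≅ : ∀ {X : Str} {R} {c c' : Vec (T1Car X) (ar R)} {τ} {a a' : Vec (Car X) (nx T τ)}
            {p : ⟦ conj (pre T τ) ⟧ X a} {p' : ⟦ conj (pre T τ) ⟧ X a'}
            {x : Any (λ α → Contrib (val X τ a p) α R c) (post T τ)} {x' : Any (λ α → Contrib (val X τ a' p') α R c') (post T τ)} →
            c ≡ c' → a ≡ a' → p ≅ p' → x ≅ x' → _≅_ {A = T1Rel X R c} (new τ a p x) {B = T1Rel X R c'} (new τ a' p' x')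
    new-≅ refl refl H.refl H.refl = H.refl

    new-element-≡ : ∀ {X : Str} {τ} {j : Fin (ny T τ)} {a a' : Vec (Car X) (nx T τ)} → a ≡ a' →
                    {p : ⟦ conj (pre T τ) ⟧ X a} {p' : ⟦ conj (pre T τ) ⟧ X a'} → p ≅ p' →
                    _≡_ {A = New X} (τ , a , p , j) (τ , a' , p' , j)
    new-element-≡ refl H.refl = refl

    val-≡ : ∀ {X : Str} τ {a a' : Vec (Car X) (nx T τ)} → a ≡ a' → {p : ⟦ conj (pre T τ) ⟧ X a} {p' : ⟦ conj (pre T τ) ⟧ X a'} →
            p ≅ p' → val X τ a p ≡ val X τ a' p'
    val-≡ τ refl H.refl = refl

    T1Hom-≈ₕ : ∀ {X Y} (f g : Hom X Y) → f ≈ₕ g → T1Hom f ≈ₕ T1Hom g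
    T1Hom-≈ₕ {X} {Y} f g f≈g = fun≗ , pres≅
      where
        fun≗ : ∀ x → T1fun f x ≡ T1fun g x
        fun≗ (inj₁ x) = cong inj₁ (proj₁ f≈g x)
        fun≗ (inj₂ (τ , a , p , j)) = cong inj₂ (new-element-≡ (map-cong (proj₁ f≈g) a) (presF-≈ₕ f g f≈g (conj (pre T τ)) a p))
        pres≅ : ∀ R c r → pres (T1Hom f) R c r ≅ pres (T1Hom g) R c r
        pres≅ R c (old d r e) = old-≅ (map-cong fun≗ c) (map-cong (proj₁ f≈g) d) (proj₂ f≈g R d r)
        pres≅ R c (new τ a p x) =
          new-≅ (map-cong fun≗ c) (map-cong (proj₁ f≈g) a) p≅
            (Any-map-≅ x (val-≡ τ (map-cong (proj₁ f≈g) a) p≅) (map-cong fun≗ c) _ _)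
          where p≅ = presF-≈ₕ f g f≈g (conj (pre T τ)) a p

    T1Hom-isIdentity : ∀ {X} (f : Hom X X) → IsIdentity f → IsIdentity (T1Hom f)
    T1Hom-isIdentity {X} f f≈id = fun≗ , pres≅
      where
        fun≗ : ∀ x → T1fun f x ≡ x
        fun≗ (inj₁ x) = cong inj₁ (proj₁ f≈id x)
        fun≗ (inj₂ (τ , a , p , j)) =
          cong inj₂ (new-element-≡ (map-id-≗ (proj₁ f≈id) a) (presF-isIdentity f f≈id (conj (pre T τ)) a p))
        pres≅ : ∀ R c r → pres (T1Hom f) R c r ≅ r
        pres≅ R c (old d r e) = old-≅ (map-id-≗ fun≗ c) (map-id-≗ (proj₁ f≈id) d) (proj₂ f≈id R d r)
        pres≅ R c (new τ a p x) =
          new-≅ (map-id-≗ fun≗ c) (map-id-≗ (proj₁ f≈id) a) p≅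
            (Any-map-≅-id (val-≡ τ (sym (map-id-≗ (proj₁ f≈id) a)) (H.sym p≅)) (sym (map-id-≗ fun≗ c)) _ x)
          where p≅ = presF-isIdentity f f≈id (conj (pre T τ)) a p

    T1Hom-∘ : ∀ {X Y Z} (g : Hom Y Z) (f : Hom X Y) → T1Hom (g ∘H f) ≈ₕ (T1Hom g ∘H T1Hom f)
    T1Hom-∘ {X} {Y} {Z} g f = fun≗ , λ R c r → H.trans (pres≅ R c r) (H.sym (H.≡-subst-removable (T1Rel Z R) _ _))
      where
        fun≗ : ∀ x → T1fun (g ∘H f) x ≡ T1fun g (T1fun f x)
        fun≗ (inj₁ x) = refl
        fun≗ (inj₂ (τ , a , p , j)) = cong inj₂ (new-element-≡ (map-∘ (fun g) (fun f) a) (presF-∘ g f (conj (pre T τ)) a p))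
        map-fun≗ : ∀ {k} (c : Vec (T1Car X) k) → map (T1fun (g ∘H f)) c ≡ map (T1fun g) (map (T1fun f) c)
        map-fun≗ c = trans (map-cong fun≗ c) (map-∘ (T1fun g) (T1fun f) c)
        pres≅ : ∀ R c r → pres (T1Hom (g ∘H f)) R c r ≅ pres (T1Hom g) R _ (pres (T1Hom f) R c r)
        pres≅ R c (old d r e) = old-≅ (map-fun≗ c) (map-∘ (fun g) (fun f) d) (H.≡-subst-removable (relS Z R) _ _)
        pres≅ R c (new τ a p x) =
          new-≅ (map-fun≗ c) (map-∘ (fun g) (fun f) a) p≅
            (H.trans (Any-map-≅ x (val-≡ τ (map-∘ (fun g) (fun f) a) p≅) (map-fun≗ c) _ _) (H.≡-to-≅ (AnyP.map-∘ _ _ x)))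
          where p≅ = presF-∘ g f (conj (pre T τ)) a p

    stageHom-id : ∀ A k → IsIdentity (stageHom k (idHom A))
    stageHom-id A zero    = idHom-isIdentity A
    stageHom-id A (suc k) = T1Hom-isIdentity _ (stageHom-id A k)

    stageHom-∘ : ∀ {A B C} (g : Hom B C) (f : Hom A B) k → stageHom k (g ∘H f) ≈ₕ (stageHom k g ∘H stageHom k f)
    stageHom-∘ g f zero    = ≈ₕ-refl (g ∘H f)
    stageHom-∘ {A} {B} {C} g f (suc k) =
      ≈ₕ-trans {X = stage (suc k) A} {Y = stage (suc k) C} {g = T1Hom (stageHom k g ∘H stageHom k f)}
        (T1Hom-≈ₕ (stageHom k (g ∘H f)) _ (stageHom-∘ g f k)) (T1Hom-∘ (stageHom k g) (stageHom k f))

  module ChaseFunctor (T : Theory) where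
    open OneStep T
    open ChainColimit T using (module Colimit)
    open Functoriality T

    chMap-incl : ∀ {A B} (f : Hom A B) k x → chMap f (incl k x) ≡ incl k (fun (stageHom k f) x)
    chMap-incl f zero    x        = refl
    chMap-incl f (suc k) (inj₁ x) = chMap-incl f k x
    chMap-incl f (suc k) (inj₂ t) = refl

    chMap-hom : ∀ {A B} (f : Hom A B) → IsHom (Ch A) (Ch B) (chMap f)
    chMap-hom f R c (k , d , r , d↦c) =
      k , map (fun (stageHom k f)) d , pres (stageHom k f) R d r ,
      trans (sym (map-∘ (incl k) _ d))
            (trans (sym (map-cong (chMap-incl f k) d)) (trans (map-∘ (chMap f) (incl k) d) (cong (map (chMap f)) d↦c)))

    isChaseFunctor : EqualityFree T → IsChaseFunctor T Ch chMap η
    isChaseFunctor ef = record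
      { W-model = λ A → Colimit.Ch-model A ef
      ; W₁-hom  = chMap-hom
      ; W₁-id   = λ { A (k , t) → trans (cong (incl k) (proj₁ (stageHom-id A k) (embed k t))) (Colimit.incl-embed A k t) }
      ; W₁-∘    = λ { g f (k , t) → trans (cong (incl k) (proj₁ (stageHom-∘ g f k) (embed k t))) (sym (chMap-incl g k _)) }
      ; η-hom   = λ A R c r → 0 , c , r , refl
      ; η-nat   = λ f x → refl
      ; η-cons  = Colimit.η-conservative }

corollary4p9 : (S : Sig) → let open Sigma S in
    (T : Theory) → IsNormal T → EqualityFree T →
    ((A : Str) → Conservative T A (OneStep.Ch T A) (OneStep.η T A))
    × IsChaseFunctor T (OneStep.Ch T) (OneStep.chMap T) (OneStep.η T)
corollary4p9 S T _ ef = Colimit.η-conservative , isChaseFunctor ef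
  where open Chase S
        open ChainColimit T using (module Colimit)
        open ChaseFunctor T
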